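{- Let $G$ be a graph and let $T$ be a connected component of $G^{AB}$ that is a tree with $|A(T)|\le 3$. Then $a(T)=2n_0(T)+n_1(T)+s_3'(T)$.
   Context: For $S\subseteq V(G)$, $N_G(S)$ is the set of vertices outside $S$ adjacent to $S$, and $d_G(v,S)$ the number of neighbours of $v$ in $S$. The strong $4$-core $C(G)$ is the maximal $S\subseteq V(G)$ with $d_G(v,S)\ge4$ for all $v\in S\cup N_G(S)$; $B(G):=N_G(C(G))$, $A(G):=V(G)\setminus(B(G)\cup C(G))$, and $G^{AB}:=G[A(G)\cup B(G)]$. For a component $T$ of $G^{AB}$, $A(T):=A(G)\cap V(T)$; $n_i(T)$ is the number of vertices of $A(T)$ with degree $i$ in $G$. A graph spans a $3$-prespider if it spans three vertices of degree at most $2$ (in $G$) with a common neighbour; $s_3'(T)$ is the number of $3$-prespiders spanned by $T$. $a(T)$ is the minimum, over all covers of $V(T)$ by vertex-disjoint paths of $T$ (length $0$ allowed), of the number of path endpoints lying in $A(T)$, where a vertex of $A(T)$ forming a path of length $0$ counts twice (equivalently, the number of endpoints in $A(T)$ of a disjoint path cover $Q$ of $G^{AB}$ minimizing the total number of endpoints in $A(G)$). -}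

module Defs where

open import Data.Nat using (ℕ; zero; suc; _+_; _*_; _≤_; _≡ᵇ_; _<ᵇ_)
open import Data.Bool using (Bool; true; false; if_then_else_; _∧_; _∨_; not)
open import Data.Fin using (Fin; toℕ) renaming (zero to fzero; suc to fsuc)
open import Data.List using (List; []; _∷_; [_]; _++_; concat; map; length)
open import Data.Nat.ListAction using (sum)
open import Data.List.Relation.Unary.All using (All)
open import Data.List.Relation.Unary.Unique.Propositional using (Unique)
open import Data.List.Membership.Propositional using (_∈_)
open import Data.Product using (Σ; _×_; ∃)
open import Data.Sum using (_⊎_)
open import Data.Empty using (⊥)
open import Relation.Nullary using (¬_)
open import Relation.Binary.PropositionalEquality using (_≡_)

record Graph (n : ℕ) : Set where
  field
    adj    : Fin n → Fin n → Bool
    sym    : ∀ u v → adj u v ≡ adj v u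
    irrefl : ∀ v → adj v v ≡ false

VSet : ℕ → Set
VSet n = Fin n → Bool

count : ∀ {n} → (Fin n → Bool) → ℕ
count {zero}  f = 0
count {suc n} f = (if f fzero then 1 else 0) + count (λ i → f (fsuc i))

sumFin : ∀ {n} → (Fin n → ℕ) → ℕ
sumFin {zero}  f = 0
sumFin {suc n} f = f fzero + sumFin (λ i → f (fsuc i))

anyFin : ∀ {n} → (Fin n → Bool) → Bool
anyFin {zero}  f = false
anyFin {suc n} f = f fzero ∨ anyFin (λ i → f (fsuc i))

module _ {n : ℕ} (G : Graph n) where
  open Graph G

  deg : Fin n → ℕ
  deg v = count (adj v)

  dIn : Fin n → VSet n → ℕ
  dIn v S = count (λ u → adj v u ∧ S u)

  nbhd : VSet n → VSet n
  nbhd S v = not (S v) ∧ anyFin (λ u → S u ∧ adj v u)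

  IsStrong4Set : VSet n → Set
  IsStrong4Set S = ∀ v → (S v ∨ nbhd S v) ≡ true → 4 ≤ dIn v S

  -- C is the (maximum = maximal, the family being union-closed) such set
  IsStrong4Core : VSet n → Set
  IsStrong4Core C = IsStrong4Set C × (∀ S → IsStrong4Set S → ∀ v → S v ≡ true → C v ≡ true)

  module Parts (C : VSet n) where
    Bset : VSet n
    Bset = nbhd C

    Aset : VSet n
    Aset v = not (C v) ∧ not (Bset v)

    ABset : VSet n
    ABset v = Aset v ∨ Bset v

  data Chain : List (Fin n) → Set where
    single : ∀ v → Chain [ v ]
    cons   : ∀ u v vs → adj u v ≡ true → Chain (v ∷ vs) → Chain (u ∷ v ∷ vs)

  InSet : VSet n → Fin n → Set
  InSet T v = T v ≡ true

  IsPathIn : VSet n → List (Fin n) → Set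
  IsPathIn T p = Chain p × All (InSet T) p × Unique p

  ConnectedIn : VSet n → Set
  ConnectedIn T = ∀ u v → T u ≡ true → T v ≡ true →
    u ≡ v ⊎ Σ (List (Fin n)) (λ p → Chain (u ∷ p ++ [ v ]) × All (InSet T) p)

  HasCycleIn : VSet n → Set
  HasCycleIn T = Σ (Fin n) λ v → Σ (List (Fin n)) λ vs →
    2 ≤ length vs × Chain (v ∷ vs ++ [ v ]) × Unique (v ∷ vs) × All (InSet T) (v ∷ vs)

  IsComponentOf : VSet n → VSet n → Set
  IsComponentOf AB T =
    (∀ v → T v ≡ true → AB v ≡ true) ×
    Σ (Fin n) (λ v → T v ≡ true) ×
    ConnectedIn T ×
    (∀ u v → T u ≡ true → AB v ≡ true → adj u v ≡ true → T v ≡ true)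

  IsTree : VSet n → Set
  IsTree T = ConnectedIn T × ¬ HasCycleIn T

  IsPathCover : VSet n → List (List (Fin n)) → Set
  IsPathCover T ps = All (IsPathIn T) ps × Unique (concat ps) ×
                     (∀ v → T v ≡ true → v ∈ concat ps)

  ind : Bool → ℕ
  ind true  = 1
  ind false = 0

  lastOf : Fin n → List (Fin n) → Fin n
  lastOf v []       = v
  lastOf v (w ∷ ws) = lastOf w ws

  -- number of endpoints of a path lying in A; a trivial path in A counts twice
  endsIn : VSet n → List (Fin n) → ℕ
  endsIn A []           = 0
  endsIn A (v ∷ [])     = 2 * ind (A v)
  endsIn A (v ∷ w ∷ ws) = ind (A v) + ind (A (lastOf w ws))

  coverCost : VSet n → List (List (Fin n)) → ℕ
  coverCost A ps = sum (map (endsIn A) ps)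

  nDeg : VSet n → VSet n → ℕ → ℕ
  nDeg A T i = count (λ v → T v ∧ A v ∧ (deg v ≡ᵇ i))

  sizeA : VSet n → VSet n → ℕ
  sizeA A T = count (λ v → T v ∧ A v)

  small : Fin n → Bool
  small v = deg v <ᵇ 3

  -- s_3'(T): number of 3-prespiders spanned by T, i.e. centres c together with
  -- 3-sets {x<y<z} of neighbours of c of degree ≤ 2 in G, all in T
  prespiders : VSet n → ℕ
  prespiders T = sumFin λ c → sumFin λ x → sumFin λ y → count λ z →
    T c ∧ T x ∧ T y ∧ T z ∧
    (toℕ x <ᵇ toℕ y) ∧ (toℕ y <ᵇ toℕ z) ∧
    adj c x ∧ adj c y ∧ adj c z ∧
    small x ∧ small y ∧ small z

module Submission where

-- Every vertex of A has all its neighbours in T, and every other vertex of T lies in B and has degree at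
-- least 4; so the vertices of T of degree at most 2 are A-vertices. The cost of a path cover is a sum over
-- A(T) of how often each vertex is an endpoint: at least 2 for degree 0, at least 1 for degree 1, and a
-- prespider forces one more, because its centre is consecutive with at most two of its three legs. With
-- |A(T)| ≤ 3 and no 4-cycles in the tree there is at most one prespider. A cover attaining the bound is
-- grown by inserting edges into a system of disjoint paths, first the edges inside A, then those at
-- A-vertices of degree at most 2, then the rest; every A-vertex then gets the links its degree allows,
-- except for the single leg that a prespider leaves out.

open import Data.Bool using (Bool; true; false; if_then_else_; _∧_; _∨_; not; T; T?)
open import Data.Bool.Properties using (∧-identityʳ; ∧-zeroʳ; ∨-zeroʳ; ∧-assoc; T-≡)
open import Data.Empty using (⊥; ⊥-elim)
open import Data.Fin using (Fin; toℕ; _≟_) renaming (zero to fzero; suc to fsuc)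
open import Data.Fin.Properties using (suc-injective; toℕ-injective)
open import Data.List using (List; []; _∷_; [_]; _++_; _∷ʳ_; map; length; concat; reverse; filterᵇ; allFin; tabulate; cartesianProduct)
open import Data.List.Membership.Propositional using (_∈_; _∉_)
open import Data.List.Membership.Propositional.Properties
  using (∈-filter⁺; ∈-filter⁻; ∈-allFin; ∈-++⁺ˡ; ∈-++⁺ʳ; ∈-++⁻; ∈-map⁻; ∈-cartesianProduct⁺; ∈-cartesianProduct⁻)
open import Data.List.Properties
  using (map-++; concat-++; concat-map-[_]; ++-assoc; unfold-reverse; reverse-involutive; length-reverse; reverse-++; length-++)
open import Data.List.Relation.Binary.Permutation.Propositional as ↭ using (_↭_; ↭⇒↭ₛ; ↭-refl; ↭-trans; ↭-sym)
open import Data.List.Relation.Binary.Permutation.Propositional.Properties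
  using (++⁺ˡ; ++⁺ʳ; shifts; ↭-reverse; All-resp-↭; Any-resp-↭; ∈-resp-↭)
import Data.List.Relation.Binary.Permutation.Setoid.Properties as PermProps
open import Data.List.Relation.Unary.All as All using (All; []; _∷_; lookup)
open import Data.List.Relation.Unary.All.Properties
  using (¬Any⇒All¬) renaming (concat⁺ to All-concat⁺; ++⁺ to All-++⁺; ++⁻ˡ to All-++⁻ˡ; ++⁻ʳ to All-++⁻ʳ)
open import Data.List.Relation.Unary.AllPairs using ([]; _∷_)
open import Data.List.Relation.Unary.Any as Any using (Any; here; there; any?)
open import Data.List.Relation.Unary.Any.Properties using () renaming (++⁺ˡ to Any-++⁺ˡ)
open import Data.List.Relation.Unary.Unique.Propositional using (Unique)
import Data.List.Relation.Unary.Unique.Propositional.Properties as Unique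
open import Data.Nat using (ℕ; zero; suc; _+_; _*_; _≤_; _<_; z≤n; s≤s; _<ᵇ_; _≡ᵇ_; _≤?_)
open import Data.Nat.ListAction using (sum)
open import Data.Nat.ListAction.Properties using (sum-++)
open import Data.Nat.Properties hiding (_≟_; suc-injective)
open import Algebra.Properties.CommutativeSemigroup +-commutativeSemigroup
  using () renaming (interchange to +-interchange; x∙yz≈y∙xz to +-x∙yz≈y∙xz)
open import Data.Product using (Σ; _×_; _,_; proj₁; proj₂)
open import Data.Sum using (_⊎_; inj₁; inj₂; [_,_]′)
import Data.Sum
open import Data.Unit using (tt)
open import Function using (_∘_; id)
open import Function.Bundles using (Equivalence)
open import Relation.Binary.Definitions using (DecidableEquality; tri<; tri≈; tri>)
open import Relation.Binary.PropositionalEquality hiding ([_])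
open import Relation.Nullary using (¬_; Dec; yes; no; does; contradiction; _⊎-dec_)
open import Relation.Nullary.Decidable using (dec-true; dec-false)

open import Defs

-- Counting over Fin

bit : Bool → ℕ
bit b = if b then 1 else 0

false≢true : false ≢ true
false≢true ()

∧-true : ∀ {a b} → a ∧ b ≡ true → a ≡ true × b ≡ true
∧-true {true} {true} _ = refl , refl

∧-intro : ∀ {a b} → a ≡ true → b ≡ true → a ∧ b ≡ true
∧-intro refl refl = refl

count-cong : ∀ {n} {f g : Fin n → Bool} → (∀ i → f i ≡ g i) → count f ≡ count g
count-cong {zero}  f≗g = refl
count-cong {suc n} f≗g = cong₂ (λ b m → bit b + m) (f≗g fzero) (count-cong (f≗g ∘ fsuc))

count-mono : ∀ {n} {f g : Fin n → Bool} → (∀ i → f i ≡ true → g i ≡ true) → count f ≤ count g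
count-mono {zero}  f⇒g = z≤n
count-mono {suc n} f⇒g = +-mono-≤ (bit-mono (f⇒g fzero)) (count-mono (f⇒g ∘ fsuc))
  where
  bit-mono : ∀ {a b} → (a ≡ true → b ≡ true) → bit a ≤ bit b
  bit-mono {false} _   = z≤n
  bit-mono {true}  a⇒b rewrite a⇒b refl = ≤-refl

count-≡0 : ∀ {n} {f : Fin n → Bool} → (∀ i → f i ≡ false) → count f ≡ 0
count-≡0 {zero}      _ = refl
count-≡0 {suc n} {f} f≡false rewrite f≡false fzero = count-≡0 (f≡false ∘ fsuc)

_without_ : ∀ {n} → (Fin n → Bool) → Fin n → Fin n → Bool
(f without v) u = f u ∧ not (does (u ≟ v))

count-without : ∀ {n} (f : Fin n → Bool) v → count f ≡ bit (f v) + count (f without v)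
count-without {suc n} f fzero rewrite ∧-zeroʳ (f fzero) =
  cong (bit (f fzero) +_) (count-cong λ i → sym (∧-identityʳ (f (fsuc i))))
count-without {suc n} f (fsuc v) rewrite count-without (f ∘ fsuc) v | ∧-identityʳ (f fzero) =
  +-x∙yz≈y∙xz (bit (f fzero)) (bit (f (fsuc v))) _

length≤count : ∀ {n} (f : Fin n → Bool) (L : List (Fin n)) → Unique L → All (λ v → f v ≡ true) L → length L ≤ count f
length≤count f []      _           _          = z≤n
length≤count f (v ∷ L) (v∉L ∷ uL) (fv ∷ fL) rewrite count-without f v | fv =
  s≤s (length≤count (f without v) L uL (still-true v∉L fL))
  where
  still-true : ∀ {L} → All (v ≢_) L → All (λ u → f u ≡ true) L → All (λ u → (f without v) u ≡ true) L
  still-true []           []          = []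
  still-true (v≢u ∷ v≢L) (fu ∷ fL) = ∧-intro fu (cong not (dec-false (_ ≟ v) (v≢u ∘ sym))) ∷ still-true v≢L fL

count-≥1 : ∀ {n} (f : Fin n → Bool) {v} → f v ≡ true → 1 ≤ count f
count-≥1 f fv = length≤count f [ _ ] ([] ∷ []) (fv ∷ [])

count-≥2 : ∀ {n} (f : Fin n → Bool) {a b} → a ≢ b → f a ≡ true → f b ≡ true → 2 ≤ count f
count-≥2 f a≢b fa fb = length≤count f (_ ∷ _ ∷ []) ((a≢b ∷ []) ∷ [] ∷ []) (fa ∷ fb ∷ [])

count-≥3 : ∀ {n} (f : Fin n → Bool) {a b c} → a ≢ b → a ≢ c → b ≢ c →
           f a ≡ true → f b ≡ true → f c ≡ true → 3 ≤ count f
count-≥3 f a≢b a≢c b≢c fa fb fc =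
  length≤count f (_ ∷ _ ∷ _ ∷ []) ((a≢b ∷ a≢c ∷ []) ∷ (b≢c ∷ []) ∷ [] ∷ []) (fa ∷ fb ∷ fc ∷ [])

count-≥4 : ∀ {n} (f : Fin n → Bool) {a b c d} → a ≢ b → a ≢ c → a ≢ d → b ≢ c → b ≢ d → c ≢ d →
           f a ≡ true → f b ≡ true → f c ≡ true → f d ≡ true → 4 ≤ count f
count-≥4 f a≢b a≢c a≢d b≢c b≢d c≢d fa fb fc fd =
  length≤count f (_ ∷ _ ∷ _ ∷ _ ∷ []) ((a≢b ∷ a≢c ∷ a≢d ∷ []) ∷ (b≢c ∷ b≢d ∷ []) ∷ (c≢d ∷ []) ∷ [] ∷ [])
    (fa ∷ fb ∷ fc ∷ fd ∷ [])

sumOver : ∀ {n} → (Fin n → ℕ) → List (Fin n) → ℕ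
sumOver f L = sum (map f L)

witnesses : ∀ {n} → (Fin n → Bool) → List (Fin n)
witnesses f = filterᵇ f (allFin _)

module _ {n : ℕ} (f : Fin n → Bool) where

  ∈-witnesses⁺ : ∀ {v} → f v ≡ true → v ∈ witnesses f
  ∈-witnesses⁺ {v} fv = ∈-filter⁺ (T? ∘ f) (∈-allFin v) (subst T (sym fv) tt)

  ∈-witnesses⁻ : ∀ {v} → v ∈ witnesses f → f v ≡ true
  ∈-witnesses⁻ v∈ = Equivalence.to T-≡ (proj₂ (∈-filter⁻ (T? ∘ f) {xs = allFin n} v∈))

  witnesses-unique : Unique (witnesses f)
  witnesses-unique = Unique.filter⁺ (T? ∘ f) (Unique.allFin⁺ n)

count-∧-tabulate : ∀ {m n} (g : Fin m → Fin n) (f h : Fin n → Bool) →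
  count (λ i → f (g i) ∧ h (g i)) ≡ sumOver (bit ∘ h) (filterᵇ f (tabulate g))
count-∧-tabulate {zero}  g f h = refl
count-∧-tabulate {suc m} g f h with f (g fzero)
... | true  = cong (bit (h (g fzero)) +_) (count-∧-tabulate (g ∘ fsuc) f h)
... | false = count-∧-tabulate (g ∘ fsuc) f h

count-∧ : ∀ {n} (f h : Fin n → Bool) → count (λ v → f v ∧ h v) ≡ sumOver (bit ∘ h) (witnesses f)
count-∧ = count-∧-tabulate id

count≡length : ∀ {n} (f : Fin n → Bool) → count f ≡ length (witnesses f)
count≡length f = begin
  count f                                   ≡⟨ count-cong (λ v → sym (∧-identityʳ (f v))) ⟩
  count (λ v → f v ∧ true)                  ≡⟨ count-∧ f (λ _ → true) ⟩
  sumOver (λ _ → 1) (witnesses f)           ≡⟨ sum-ones (witnesses f) ⟩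
  length (witnesses f)                      ∎
  where
  open ≡-Reasoning
  sum-ones : (L : List (Fin _)) → sumOver (λ _ → 1) L ≡ length L
  sum-ones []      = refl
  sum-ones (_ ∷ L) = cong suc (sum-ones L)

module _ {n : ℕ} (f : Fin n → Bool) where

  count-≥1⇒witness : 1 ≤ count f → Σ (Fin n) λ a → f a ≡ true
  count-≥1⇒witness 1≤ with witnesses f | count≡length f | ∈-witnesses⁻ f
  ... | a ∷ _ | _  | sound = a , sound (here refl)
  ... | []    | eq | _     = contradiction (subst (1 ≤_) eq 1≤) λ ()

  count-≥2⇒witnesses : 2 ≤ count f → Σ (Fin n) λ a → Σ (Fin n) λ b → a ≢ b × f a ≡ true × f b ≡ true
  count-≥2⇒witnesses 2≤ with witnesses f | count≡length f | ∈-witnesses⁻ f | witnesses-unique f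
  ... | a ∷ b ∷ _ | _  | sound | (a≢b ∷ _) ∷ _ = a , b , a≢b , sound (here refl) , sound (there (here refl))
  ... | []        | eq | _     | _ = contradiction (subst (2 ≤_) eq 2≤) λ ()
  ... | _ ∷ []    | eq | _     | _ = contradiction (subst (2 ≤_) eq 2≤) λ { (s≤s ()) }

  count-≥3⇒witnesses : 3 ≤ count f → Σ (Fin n) λ a → Σ (Fin n) λ b → Σ (Fin n) λ c →
    a ≢ b × a ≢ c × b ≢ c × f a ≡ true × f b ≡ true × f c ≡ true
  count-≥3⇒witnesses 3≤ with witnesses f | count≡length f | ∈-witnesses⁻ f | witnesses-unique f
  ... | a ∷ b ∷ c ∷ _ | _ | sound | (a≢b ∷ a≢c ∷ _) ∷ (b≢c ∷ _) ∷ _ =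
    a , b , c , a≢b , a≢c , b≢c , sound (here refl) , sound (there (here refl)) , sound (there (there (here refl)))
  ... | []         | eq | _ | _ = contradiction (subst (3 ≤_) eq 3≤) λ ()
  ... | _ ∷ []     | eq | _ | _ = contradiction (subst (3 ≤_) eq 3≤) λ { (s≤s ()) }
  ... | _ ∷ _ ∷ [] | eq | _ | _ = contradiction (subst (3 ≤_) eq 3≤) λ { (s≤s (s≤s ())) }

  count-unique : ∀ {v} → f v ≡ true → (∀ u → f u ≡ true → u ≡ v) → count f ≡ 1
  count-unique {v} fv unique rewrite count-without f v | fv = cong suc (count-≡0 only-v)
    where
    only-v : ∀ u → (f without v) u ≡ false
    only-v u with f u in fu | u ≟ v
    ... | false | _     = refl
    ... | true  | yes _ = refl
    ... | true  | no u≢v = contradiction (unique u fu) u≢v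

sumFin-≥ : ∀ {n} (f : Fin n → ℕ) i → f i ≤ sumFin f
sumFin-≥ f fzero    = m≤m+n _ _
sumFin-≥ f (fsuc i) = ≤-trans (sumFin-≥ (f ∘ fsuc) i) (m≤n+m _ _)

sumFin-≥1⇒witness : ∀ {n} (f : Fin n → ℕ) → 1 ≤ sumFin f → Σ (Fin n) λ i → 1 ≤ f i
sumFin-≥1⇒witness {suc n} f 1≤ with f fzero in f0
... | suc _ = fzero , subst (1 ≤_) (sym f0) (s≤s z≤n)
... | zero  = let (i , 1≤fi) = sumFin-≥1⇒witness (f ∘ fsuc) 1≤ in fsuc i , 1≤fi

sumFin-≡0 : ∀ {n} (f : Fin n → ℕ) → (∀ i → f i ≡ 0) → sumFin f ≡ 0
sumFin-≡0 {zero}  f _      = refl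
sumFin-≡0 {suc n} f f≡0 rewrite f≡0 fzero = sumFin-≡0 (f ∘ fsuc) (f≡0 ∘ fsuc)

sumFin-unique : ∀ {n} (f : Fin n → ℕ) v → (∀ i → i ≢ v → f i ≡ 0) → sumFin f ≡ f v
sumFin-unique f fzero    vanish =
  trans (cong (f fzero +_) (sumFin-≡0 (f ∘ fsuc) λ i → vanish (fsuc i) λ ())) (+-identityʳ _)
sumFin-unique f (fsuc v) vanish rewrite vanish fzero (λ ()) =
  sumFin-unique (f ∘ fsuc) v λ i i≢v → vanish (fsuc i) (i≢v ∘ suc-injective)

module _ {n : ℕ} where

  private
    V = Fin n

  sumOver-++ : ∀ (f : V → ℕ) l r → sumOver f (l ++ r) ≡ sumOver f l + sumOver f r
  sumOver-++ f l r = trans (cong sum (map-++ f l r)) (sum-++ (map f l) (map f r))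

  sumOver-+ : ∀ (f g : V → ℕ) L → sumOver (λ v → f v + g v) L ≡ sumOver f L + sumOver g L
  sumOver-+ f g []      = refl
  sumOver-+ f g (x ∷ L) rewrite sumOver-+ f g L = +-interchange (f x) (g x) (sumOver f L) (sumOver g L)

  sumOver-mono : ∀ {f g : V → ℕ} L → (∀ {v} → v ∈ L → f v ≤ g v) → sumOver f L ≤ sumOver g L
  sumOver-mono []      _   = z≤n
  sumOver-mono (x ∷ L) f≤g = +-mono-≤ (f≤g (here refl)) (sumOver-mono L (f≤g ∘ there))

  sumOver-mono-strict : ∀ {f g : V → ℕ} L {w} → (∀ {v} → v ∈ L → f v ≤ g v) → w ∈ L → f w < g w →
                        sumOver f L < sumOver g L
  sumOver-mono-strict (x ∷ L) f≤g (here refl) fw<gw = +-mono-<-≤ fw<gw (sumOver-mono L (f≤g ∘ there))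
  sumOver-mono-strict (x ∷ L) f≤g (there w∈L) fw<gw =
    +-mono-≤-< (f≤g (here refl)) (sumOver-mono-strict L (f≤g ∘ there) w∈L fw<gw)

  sumOver-≡0 : ∀ (f : V → ℕ) L → (∀ {v} → v ∈ L → f v ≡ 0) → sumOver f L ≡ 0
  sumOver-≡0 f []      _   = refl
  sumOver-≡0 f (x ∷ L) f≡0 rewrite f≡0 (here refl) = sumOver-≡0 f L (f≡0 ∘ there)

  sumOver-≤1 : ∀ (f : V → ℕ) L → Unique L → (∀ v → f v ≤ 1) →
               (∀ {v w} → v ∈ L → w ∈ L → 1 ≤ f v → 1 ≤ f w → v ≡ w) → sumOver f L ≤ 1
  sumOver-≤1 f []      _          _    _        = z≤n
  sumOver-≤1 f (x ∷ L) (x∉L ∷ uL) f≤1 at-most-one with f x in fx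
  ... | zero  = sumOver-≤1 f L uL f≤1 (λ v∈ w∈ → at-most-one (there v∈) (there w∈))
  ... | suc k = begin
    suc k + sumOver f L  ≡⟨ cong (suc k +_) (sumOver-≡0 f L rest≡0) ⟩
    suc k + 0            ≡⟨ +-identityʳ (suc k) ⟩
    suc k                ≡⟨ fx ⟨
    f x                  ≤⟨ f≤1 x ⟩
    1                    ∎
    where
    open ≤-Reasoning
    1≤fx : 1 ≤ f x
    1≤fx rewrite fx = s≤s z≤n
    rest≡0 : ∀ {v} → v ∈ L → f v ≡ 0
    rest≡0 {v} v∈L with f v in fv
    ... | zero  = refl
    ... | suc _ = contradiction (at-most-one (here refl) (there v∈L) 1≤fx (subst (1 ≤_) (sym fv) (s≤s z≤n))) (lookup x∉L v∈L)

  occurrences : V → List V → ℕ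
  occurrences v = sumOver (λ x → bit (does (v ≟ x)))

  private
    indicator-∈ : ∀ {e} L → Unique L → e ∈ L → sumOver (λ v → bit (does (v ≟ e))) L ≡ 1
    indicator-∈ {e} (x ∷ L) (x∉L ∷ uL) (here refl) rewrite dec-true (e ≟ e) refl =
      cong suc (sumOver-≡0 _ L λ {v} v∈L → cong bit (dec-false (v ≟ e) (lookup x∉L v∈L ∘ sym)))
    indicator-∈ {e} (x ∷ L) (x∉L ∷ uL) (there e∈L) rewrite dec-false (x ≟ e) (lookup x∉L e∈L) =
      indicator-∈ L uL e∈L

    indicator-∉ : ∀ {e} L → e ∉ L → sumOver (λ v → bit (does (v ≟ e))) L ≡ 0
    indicator-∉ {e} L e∉L = sumOver-≡0 _ L λ {v} v∈L → cong bit (dec-false (v ≟ e) λ { refl → e∉L v∈L })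

  sumOver-bit≡sumOver-occurrences : ∀ (g : V → Bool) L E → Unique L → (∀ {v} → v ∈ L → g v ≡ true) →
    (∀ {e} → e ∈ E → g e ≡ true → e ∈ L) → sumOver (bit ∘ g) E ≡ sumOver (λ v → occurrences v E) L
  sumOver-bit≡sumOver-occurrences g L []      uL gL EL = sym (sumOver-≡0 _ L λ _ → refl)
  sumOver-bit≡sumOver-occurrences g L (e ∷ E) uL gL EL = begin
    bit (g e) + sumOver (bit ∘ g) E
      ≡⟨ cong₂ _+_ first (sumOver-bit≡sumOver-occurrences g L E uL gL (EL ∘ there)) ⟩
    sumOver (λ v → bit (does (v ≟ e))) L + sumOver (λ v → occurrences v E) L
      ≡⟨ sumOver-+ (λ v → bit (does (v ≟ e))) (λ v → occurrences v E) L ⟨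
    sumOver (λ v → occurrences v (e ∷ E)) L ∎
    where
    open ≡-Reasoning
    first : bit (g e) ≡ sumOver (λ v → bit (does (v ≟ e))) L
    first with g e in ge
    ... | true  = sym (indicator-∈ L uL (EL (here refl) ge))
    ... | false = sym (indicator-∉ L λ e∈L → false≢true (trans (sym ge) (gL e∈L)))

-- Consecutive elements of lists

module _ {A : Set} where

  data Consecutive : List A → A → A → Set where
    here  : ∀ {a b l} → Consecutive (a ∷ b ∷ l) a b
    there : ∀ {x a b l} → Consecutive l a b → Consecutive (x ∷ l) a b

  Adjacent : List A → A → A → Set
  Adjacent l a b = Consecutive l a b ⊎ Consecutive l b a

  end : A → List A → A
  end v []       = v
  end v (w ∷ ws) = end w ws

  end-∈ : ∀ x l → end x l ∈ x ∷ l
  end-∈ x []      = here refl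
  end-∈ x (y ∷ l) = there (end-∈ y l)

  consecutive-∈ˡ : ∀ {l a b} → Consecutive l a b → a ∈ l
  consecutive-∈ˡ here      = here refl
  consecutive-∈ˡ (there c) = there (consecutive-∈ˡ c)

  consecutive-∈ʳ : ∀ {l a b} → Consecutive l a b → b ∈ l
  consecutive-∈ʳ here      = there (here refl)
  consecutive-∈ʳ (there c) = there (consecutive-∈ʳ c)

  consecutive-∈ʳ-tail : ∀ {x l a b} → Consecutive (x ∷ l) a b → b ∈ l
  consecutive-∈ʳ-tail here      = here refl
  consecutive-∈ʳ-tail (there c) = consecutive-∈ʳ c

  adjacent-∈ : ∀ {l a b} → Adjacent l a b → a ∈ l
  adjacent-∈ (inj₁ c) = consecutive-∈ˡ c
  adjacent-∈ (inj₂ c) = consecutive-∈ʳ c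

  adjacent-sym : ∀ {l a b} → Adjacent l a b → Adjacent l b a
  adjacent-sym (inj₁ c) = inj₂ c
  adjacent-sym (inj₂ c) = inj₁ c

  consecutive-≢ : ∀ {l a b} → Unique l → Consecutive l a b → a ≢ b
  consecutive-≢ (x∉ ∷ _) here      = lookup x∉ (here refl)
  consecutive-≢ (_ ∷ u)  (there c) = consecutive-≢ u c

  predecessor-unique : ∀ {l x y c} → Unique l → Consecutive l x c → Consecutive l y c → x ≡ y
  predecessor-unique u                 here       here       = refl
  predecessor-unique (_ ∷ (b∉ ∷ _))    here       (there c)  = contradiction refl (lookup b∉ (consecutive-∈ʳ-tail c))
  predecessor-unique (_ ∷ (b∉ ∷ _))    (there c)  here       = contradiction refl (lookup b∉ (consecutive-∈ʳ-tail c))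
  predecessor-unique (_ ∷ u)           (there c₁) (there c₂) = predecessor-unique u c₁ c₂

  successor-unique : ∀ {l x y c} → Unique l → Consecutive l c x → Consecutive l c y → x ≡ y
  successor-unique u          here       here       = refl
  successor-unique (a∉ ∷ _)   here       (there c)  = contradiction refl (lookup a∉ (consecutive-∈ˡ c))
  successor-unique (a∉ ∷ _)   (there c)  here       = contradiction refl (lookup a∉ (consecutive-∈ˡ c))
  successor-unique (_ ∷ u)    (there c₁) (there c₂) = successor-unique u c₁ c₂

  consecutive-asym : ∀ {l a b} → Unique l → Consecutive l a b → Consecutive l b a → ⊥
  consecutive-asym u        here      here      = consecutive-≢ u here refl
  consecutive-asym (a∉ ∷ _) here      (there c) = lookup a∉ (consecutive-∈ʳ c) refl
  consecutive-asym (a∉ ∷ _) (there c) here      = lookup a∉ (consecutive-∈ʳ c) refl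
  consecutive-asym (_ ∷ u)  (there c) (there d) = consecutive-asym u c d

  predecessor≢successor : ∀ {l u v w} → Unique l → Consecutive l u v → Consecutive l v w → u ≢ w
  predecessor≢successor u c d refl = consecutive-asym u c d

  successor≢head : ∀ {x l u v} → Unique (x ∷ l) → Consecutive (x ∷ l) u v → v ≢ x
  successor≢head (x∉ ∷ _) c v≡x = lookup x∉ (consecutive-∈ʳ-tail c) (sym v≡x)

  predecessor≢end : ∀ {x l v w} → Unique (x ∷ l) → Consecutive (x ∷ l) v w → v ≢ end x l
  predecessor≢end {l = w ∷ l} (x∉ ∷ _) here      = lookup x∉ (end-∈ w l)
  predecessor≢end {l = _ ∷ _} (_ ∷ u)  (there c) = predecessor≢end u c

  predecessor-exists : ∀ {x l v} → v ∈ l → Σ A λ u → Consecutive (x ∷ l) u v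
  predecessor-exists {x} (here refl) = x , here
  predecessor-exists {l = y ∷ _} (there v∈) = let (u , c) = predecessor-exists {x = y} v∈ in u , there c

  successor-exists : ∀ {x l v} → v ∈ x ∷ l → v ≢ end x l → Σ A λ w → Consecutive (x ∷ l) v w
  successor-exists {l = []}    (here refl) v≢end = contradiction refl v≢end
  successor-exists {l = y ∷ l} (here refl) _     = y , here
  successor-exists {l = y ∷ l} (there v∈)  v≢end = let (w , c) = successor-exists v∈ v≢end in w , there c

  adjacent-twice : ∀ {p v w₁ w₂} → Unique p → Adjacent p v w₁ → Adjacent p v w₂ → w₁ ≢ w₂ →
                   Σ A λ u → Σ A λ w → Consecutive p u v × Consecutive p v w
  adjacent-twice u (inj₁ c₁) (inj₁ c₂) w₁≢w₂ = contradiction (successor-unique u c₁ c₂) w₁≢w₂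
  adjacent-twice u (inj₁ c₁) (inj₂ c₂) _     = _ , _ , c₂ , c₁
  adjacent-twice u (inj₂ c₁) (inj₁ c₂) _     = _ , _ , c₁ , c₂
  adjacent-twice u (inj₂ c₁) (inj₂ c₂) w₁≢w₂ = contradiction (predecessor-unique u c₁ c₂) w₁≢w₂

  consecutive-++ˡ : ∀ {l r a b} → Consecutive l a b → Consecutive (l ++ r) a b
  consecutive-++ˡ here      = here
  consecutive-++ˡ (there c) = there (consecutive-++ˡ c)

  consecutive-++ʳ : ∀ l {r a b} → Consecutive r a b → Consecutive (l ++ r) a b
  consecutive-++ʳ []      c = c
  consecutive-++ʳ (x ∷ l) c = there (consecutive-++ʳ l c)

  adjacent-++ˡ : ∀ {l r a b} → Adjacent l a b → Adjacent (l ++ r) a b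
  adjacent-++ˡ = Data.Sum.map consecutive-++ˡ consecutive-++ˡ

  adjacent-++ʳ : ∀ l {r a b} → Adjacent r a b → Adjacent (l ++ r) a b
  adjacent-++ʳ l = Data.Sum.map (consecutive-++ʳ l) (consecutive-++ʳ l)

  consecutive-join : ∀ l a b r → Consecutive ((l ∷ʳ a) ++ (b ∷ r)) a b
  consecutive-join l a b r rewrite ++-assoc l [ a ] (b ∷ r) = consecutive-++ʳ l here

  consecutive-++⁻ : ∀ l a b r {x y} → Consecutive ((l ∷ʳ a) ++ (b ∷ r)) x y →
                    Consecutive (l ∷ʳ a) x y ⊎ Consecutive (b ∷ r) x y ⊎ (x ≡ a × y ≡ b)
  consecutive-++⁻ []          a b r here      = inj₂ (inj₂ (refl , refl))
  consecutive-++⁻ []          a b r (there c) = inj₂ (inj₁ c)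
  consecutive-++⁻ (x ∷ [])    a b r here      = inj₁ here
  consecutive-++⁻ (x ∷ y ∷ l) a b r here      = inj₁ here
  consecutive-++⁻ (x ∷ l)     a b r (there c) with consecutive-++⁻ l a b r c
  ... | inj₁ c′ = inj₁ (there c′)
  ... | inj₂ c′ = inj₂ c′

  consecutive-reverse : ∀ {l a b} → Consecutive l a b → Consecutive (reverse l) b a
  consecutive-reverse {a ∷ b ∷ l} here rewrite unfold-reverse a (b ∷ l) | unfold-reverse b l
    | ++-assoc (reverse l) [ b ] [ a ] = consecutive-++ʳ (reverse l) here
  consecutive-reverse {x ∷ l} (there c) rewrite unfold-reverse x l = consecutive-++ˡ (consecutive-reverse c)

  adjacent-reverse : ∀ {l a b} → Adjacent l a b → Adjacent (reverse l) a b
  adjacent-reverse (inj₁ c) = inj₂ (consecutive-reverse c)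
  adjacent-reverse (inj₂ c) = inj₁ (consecutive-reverse c)

  adjacent-reverse⁻ : ∀ {l a b} → Adjacent (reverse l) a b → Adjacent l a b
  adjacent-reverse⁻ {l} = subst (λ l′ → Adjacent l′ _ _) (reverse-involutive l) ∘ adjacent-reverse

  adjacent-at-most-two : ∀ {l c x y z} → Unique l → Adjacent l c x → Adjacent l c y → Adjacent l c z →
                         x ≢ y → x ≢ z → y ≢ z → ⊥
  adjacent-at-most-two u (inj₁ a) (inj₁ b) _        x≢y _   _   = x≢y (successor-unique u a b)
  adjacent-at-most-two u (inj₂ a) (inj₂ b) _        x≢y _   _   = x≢y (predecessor-unique u a b)
  adjacent-at-most-two u (inj₁ a) (inj₂ _) (inj₁ d) _   x≢z _   = x≢z (successor-unique u a d)
  adjacent-at-most-two u (inj₁ _) (inj₂ b) (inj₂ d) _   _   y≢z = y≢z (predecessor-unique u b d)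
  adjacent-at-most-two u (inj₂ _) (inj₁ b) (inj₁ d) _   _   y≢z = y≢z (successor-unique u b d)
  adjacent-at-most-two u (inj₂ a) (inj₁ _) (inj₂ d) _   x≢z _   = x≢z (predecessor-unique u a d)

  end-∷ʳ : ∀ x l → Σ (List A) λ init → x ∷ l ≡ init ∷ʳ end x l
  end-∷ʳ x []      = [] , refl
  end-∷ʳ x (y ∷ l) = let (init , eq) = end-∷ʳ y l in x ∷ init , cong (x ∷_) eq

  end-of-∷ʳ : ∀ x l y → end x (l ∷ʳ y) ≡ y
  end-of-∷ʳ x []      y = refl
  end-of-∷ʳ x (z ∷ l) y = end-of-∷ʳ z l y

  unique-++⁻ˡ : ∀ l {r : List A} → Unique (l ++ r) → Unique l
  unique-++⁻ˡ []      _         = []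
  unique-++⁻ˡ (x ∷ l) (x∉ ∷ u) = All-++⁻ˡ l x∉ ∷ unique-++⁻ˡ l u

  unique-++⁻ʳ : ∀ l {r : List A} → Unique (l ++ r) → Unique r
  unique-++⁻ʳ []      u       = u
  unique-++⁻ʳ (x ∷ l) (_ ∷ u) = unique-++⁻ʳ l u

  unique-++-disjoint : ∀ l {r : List A} {x} → Unique (l ++ r) → x ∈ l → x ∉ r
  unique-++-disjoint (y ∷ l) (y∉ ∷ _) (here refl) x∈r = lookup (All-++⁻ʳ l y∉) x∈r refl
  unique-++-disjoint (y ∷ l) (_ ∷ u)  (there x∈l) = unique-++-disjoint l u x∈l

  unique-↭ : ∀ {xs ys : List A} → xs ↭ ys → Unique xs → Unique ys
  unique-↭ σ = PermProps.Unique-resp-↭ (setoid A) (↭⇒↭ₛ σ)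

  concat-↭ : ∀ {M N : List (List A)} → M ↭ N → concat M ↭ concat N
  concat-↭ ↭.refl         = ↭-refl
  concat-↭ (↭.prep p σ)   = ++⁺ˡ p (concat-↭ σ)
  concat-↭ (↭.swap p q σ) = ↭-trans (shifts p q) (++⁺ˡ q (++⁺ˡ p (concat-↭ σ)))
  concat-↭ (↭.trans σ τ)  = ↭-trans (concat-↭ σ) (concat-↭ τ)

  consecutive? : DecidableEquality A → ∀ l a b → Dec (Consecutive l a b)
  consecutive? _≟ₐ_ []          a b = no λ ()
  consecutive? _≟ₐ_ (x ∷ [])    a b = no λ { (there ()) }
  consecutive? _≟ₐ_ (x ∷ y ∷ l) a b with x ≟ₐ a | y ≟ₐ b | consecutive? _≟ₐ_ (y ∷ l) a b
  ... | yes refl | yes refl | _     = yes here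
  ... | _        | _        | yes c = yes (there c)
  ... | no x≢a   | _        | no ¬c = no λ { here → x≢a refl ; (there c) → ¬c c }
  ... | yes _    | no y≢b   | no ¬c = no λ { here → y≢b refl ; (there c) → ¬c c }

-- Systems of vertex-disjoint paths

module PathSystems {n : ℕ} (G : Graph n) (T : VSet n) where

  open Graph G renaming (sym to adj-sym)

  open import Data.List.Membership.DecPropositional (_≟_ {n}) using (_∈?_)

  private
    V = Fin n

  adj-swap : ∀ {a b} → adj a b ≡ true → adj b a ≡ true
  adj-swap {a} {b} = trans (adj-sym b a)

  adj-≢ : ∀ {a b} → adj a b ≡ true → a ≢ b
  adj-≢ {a} ab refl = false≢true (trans (sym (irrefl a)) ab)

  WalkIn : List V → Set
  WalkIn p = Chain G p × All (InSet G T) p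

  IsPathSystem : List (List V) → Set
  IsPathSystem M = All WalkIn M × Unique (concat M)

  Link : List (List V) → V → V → Set
  Link M a b = Any (λ p → Adjacent p a b) M

  Interior : List (List V) → V → Set
  Interior M v = Σ V λ x → Σ V λ y → x ≢ y × Link M v x × Link M v y

  link? : ∀ M a b → Dec (Link M a b)
  link? M a b = any? (λ p → consecutive? _≟_ p a b ⊎-dec consecutive? _≟_ p b a) M

  interior-here : ∀ {p M u v w} → Unique p → Consecutive p u v → Consecutive p v w → Interior (p ∷ M) v
  interior-here u c d = _ , _ , predecessor≢successor u c d , here (inj₂ c) , here (inj₁ d)

  link-sym : ∀ {M a b} → Link M a b → Link M b a
  link-sym = Any.map adjacent-sym

  link-∈ : ∀ {M a b} → Link M a b → a ∈ concat M
  link-∈ {p ∷ M} (here c)  = ∈-++⁺ˡ (adjacent-∈ c)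
  link-∈ {p ∷ M} (there l) = ∈-++⁺ʳ p (link-∈ l)

  link-at-most-two : ∀ {M c x y z} → Unique (concat M) → Link M c x → Link M c y → Link M c z →
                     x ≢ y → x ≢ z → y ≢ z → ⊥
  link-at-most-two u lx ly lz = adjacent-at-most-two u (link-concat lx) (link-concat ly) (link-concat lz)
    where
    link-concat : ∀ {M a b} → Link M a b → Adjacent (concat M) a b
    link-concat {p ∷ M} (here c)  = adjacent-++ˡ c
    link-concat {p ∷ M} (there l) = adjacent-++ʳ p (link-concat l)

  chain⇒adj : ∀ {p a b} → Chain G p → Consecutive p a b → adj a b ≡ true
  chain⇒adj (cons _ _ _ ab _) here      = ab
  chain⇒adj (cons _ _ _ _ ch) (there c) = chain⇒adj ch c

  adj⇒chain : ∀ x l → (∀ {a b} → Consecutive (x ∷ l) a b → adj a b ≡ true) → Chain G (x ∷ l)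
  adj⇒chain x []      _   = single x
  adj⇒chain x (y ∷ l) adj = cons x y l (adj here) (adj⇒chain y l (adj ∘ there))

  valid-adj : ∀ {M x y} → IsPathSystem M → Link M x y → adj x y ≡ true
  valid-adj ((ok ∷ _) , _) (here (inj₁ c)) = chain⇒adj (proj₁ ok) c
  valid-adj ((ok ∷ _) , _) (here (inj₂ c)) = adj-swap (chain⇒adj (proj₁ ok) c)
  valid-adj {p ∷ M} ((_ ∷ oks) , u) (there l) = valid-adj (oks , unique-++⁻ʳ p u) l

  walkIn-reverse : ∀ {p} → WalkIn p → WalkIn (reverse p)
  walkIn-reverse {x ∷ l} (ch , inT) with reverse (x ∷ l) in eq
  ... | []    = contradiction (trans (sym (length-reverse (x ∷ l))) (cong length eq)) λ ()
  ... | y ∷ r = adj⇒chain y r (λ c → adj-swap (chain⇒adj ch (reversed c))) ,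
                subst (All (InSet G T)) eq (All-resp-↭ (↭-sym (↭-reverse (x ∷ l))) inT)
    where
    reversed : ∀ {a b} → Consecutive (y ∷ r) a b → Consecutive (x ∷ l) b a
    reversed {a} {b} c = subst (λ l′ → Consecutive l′ b a) (reverse-involutive (x ∷ l))
                           (consecutive-reverse (subst (λ l′ → Consecutive l′ a b) (sym eq) c))

  -- A one-vertex path lists its vertex twice, as endsIn counts it.
  ends : List V → List V
  ends []      = []
  ends (v ∷ l) = v ∷ end v l ∷ []

  endpoints : List (List V) → List V
  endpoints M = concat (map ends M)

  private
    bit≤1 : ∀ b → bit b ≤ 1
    bit≤1 true  = ≤-refl
    bit≤1 false = z≤n

    bit-≢ : ∀ {v x : V} → v ≢ x → bit (does (v ≟ x)) ≡ 0
    bit-≢ {v} {x} v≢x = cong bit (dec-false (v ≟ x) v≢x)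

  ends-∉ : ∀ {v} p → v ∉ p → occurrences v (ends p) ≡ 0
  ends-∉ []      _   = refl
  ends-∉ {v} (x ∷ l) v∉ rewrite bit-≢ {v} {x} (v∉ ∘ here)
    | bit-≢ {v} {end x l} (λ v≡ → v∉ (subst (_∈ x ∷ l) (sym v≡) (end-∈ x l))) = refl

  ends-≤2 : ∀ v p → occurrences v (ends p) ≤ 2
  ends-≤2 v []      = z≤n
  ends-≤2 v (x ∷ l) = +-mono-≤ (bit≤1 (does (v ≟ x))) (+-mono-≤ (bit≤1 (does (v ≟ end x l))) z≤n)

  ends-≤1 : ∀ {v w} p → Unique p → Adjacent p v w → occurrences v (ends p) ≤ 1
  ends-≤1 {v} (x ∷ y ∷ l) (x∉ ∷ _) _ with v ≟ x
  ... | yes refl rewrite bit-≢ (lookup x∉ (end-∈ y l)) = ≤-refl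
  ... | no _     = +-mono-≤ (bit≤1 _) z≤n
  ends-≤1 (_ ∷ []) _ (inj₁ (there ()))
  ends-≤1 (_ ∷ []) _ (inj₂ (there ()))
  ends-≤1 []       _ (inj₁ ())
  ends-≤1 []       _ (inj₂ ())

  ends-interior : ∀ {u v w} p → Unique p → Consecutive p u v → Consecutive p v w → occurrences v (ends p) ≡ 0
  ends-interior (x ∷ l) u c d rewrite bit-≢ (successor≢head u c) | bit-≢ (predecessor≢end u d) = refl

  ends-≥2-or-adjacent : ∀ {v} p → v ∈ p → 2 ≤ occurrences v (ends p) ⊎ Σ V λ w → Adjacent p v w
  ends-≥2-or-adjacent {v} (x ∷ [])    (here refl) rewrite dec-true (v ≟ v) refl = inj₁ ≤-refl
  ends-≥2-or-adjacent     (x ∷ y ∷ l) (here refl) = inj₂ (y , inj₁ here)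
  ends-≥2-or-adjacent     (x ∷ y ∷ l) (there v∈) = let (u , c) = predecessor-exists v∈ in inj₂ (u , inj₂ c)

  ends-≥1-or-interior : ∀ {v} p → v ∈ p → 1 ≤ occurrences v (ends p) ⊎
                        Σ V λ u → Σ V λ w → Consecutive p u v × Consecutive p v w
  ends-≥1-or-interior {v} (x ∷ l) v∈ with v ≟ x | v ≟ end x l
  ... | yes _   | _       = inj₁ (s≤s z≤n)
  ... | no _    | yes _   = inj₁ (s≤s z≤n)
  ... | no v≢x  | no v≢e  with v∈
  ...   | here v≡x = contradiction v≡x v≢x
  ...   | there v∈l = let (u , c) = predecessor-exists v∈l ; (w , d) = successor-exists v∈ v≢e in
                      inj₂ (u , w , c , d)

  private
    split : ∀ (v : V) p M → occurrences v (endpoints (p ∷ M)) ≡ occurrences v (ends p) + occurrences v (endpoints M)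
    split v p M = sumOver-++ (λ x → bit (does (v ≟ x))) (ends p) (endpoints M)

  endpoints-∉ : ∀ {v} M → v ∉ concat M → occurrences v (endpoints M) ≡ 0
  endpoints-∉     []      _   = refl
  endpoints-∉ {v} (p ∷ M) v∉ =
    trans (split v p M) (cong₂ _+_ (ends-∉ p (v∉ ∘ ∈-++⁺ˡ)) (endpoints-∉ M (v∉ ∘ ∈-++⁺ʳ p)))

  private
    in-head : ∀ {v p M} → Unique (concat (p ∷ M)) → v ∈ p →
              occurrences v (endpoints (p ∷ M)) ≡ occurrences v (ends p)
    in-head {v} {p} {M} u v∈p =
      trans (split v p M) (trans (cong (_ +_) (endpoints-∉ M (unique-++-disjoint p u v∈p))) (+-identityʳ _))

    not-in-head : ∀ {v p M} → v ∉ p → occurrences v (endpoints (p ∷ M)) ≡ occurrences v (endpoints M)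
    not-in-head {v} {p} {M} v∉p = trans (split v p M) (cong (_+ _) (ends-∉ p v∉p))

    link-in-head : ∀ {p M v w} → Unique (p ++ concat M) → v ∈ p → Link (p ∷ M) v w → Adjacent p v w
    link-in-head     u v∈p (here c)  = c
    link-in-head {p} u v∈p (there l) = contradiction (link-∈ l) (unique-++-disjoint p u v∈p)

  endpoints-≤2 : ∀ v M → Unique (concat M) → occurrences v (endpoints M) ≤ 2
  endpoints-≤2 v []      _ = z≤n
  endpoints-≤2 v (p ∷ M) u with v ∈? p
  ... | yes v∈p = subst (_≤ 2) (sym (in-head {M = M} u v∈p)) (ends-≤2 v p)
  ... | no  v∉p = subst (_≤ 2) (sym (not-in-head {M = M} v∉p)) (endpoints-≤2 v M (unique-++⁻ʳ p u))

  endpoints-linked : ∀ {v w} M → Unique (concat M) → Link M v w → occurrences v (endpoints M) ≤ 1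
  endpoints-linked (p ∷ M) u (here c) =
    subst (_≤ 1) (sym (in-head {M = M} u (adjacent-∈ c))) (ends-≤1 p (unique-++⁻ˡ p u) c)
  endpoints-linked (p ∷ M) u (there l) =
    subst (_≤ 1) (sym (not-in-head {M = M} (λ v∈p → unique-++-disjoint p u v∈p (link-∈ l))))
      (endpoints-linked M (unique-++⁻ʳ p u) l)

  endpoints-interior : ∀ {v} M → Unique (concat M) → Interior M v → occurrences v (endpoints M) ≡ 0
  endpoints-interior (p ∷ M) u (x , y , x≢y , here c , l) =
    let (_ , _ , c₁ , c₂) = adjacent-twice (unique-++⁻ˡ p u) c (link-in-head u (adjacent-∈ c) l) x≢y
    in trans (in-head {M = M} u (adjacent-∈ c)) (ends-interior p (unique-++⁻ˡ p u) c₁ c₂)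
  endpoints-interior {v} (p ∷ M) u (x , y , x≢y , there l₁ , l₂) =
    trans (not-in-head {M = M} (λ v∈p → unique-++-disjoint p u v∈p (link-∈ l₁)))
      (endpoints-interior M (unique-++⁻ʳ p u) (x , y , x≢y , l₁ , in-tail l₂))
    where
    in-tail : Link (p ∷ M) v y → Link M v y
    in-tail (here c)  = contradiction (link-∈ l₁) (unique-++-disjoint p u (adjacent-∈ c))
    in-tail (there l) = l

  endpoints-≥2-or-linked : ∀ {v} M → v ∈ concat M → 2 ≤ occurrences v (endpoints M) ⊎ Σ V (Link M v)
  endpoints-≥2-or-linked {v} (p ∷ M) v∈ rewrite split v p M with ∈-++⁻ p v∈
  ... | inj₁ v∈p with ends-≥2-or-adjacent p v∈p
  ...   | inj₁ 2≤      = inj₁ (≤-trans 2≤ (m≤m+n _ _))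
  ...   | inj₂ (w , c) = inj₂ (w , here c)
  endpoints-≥2-or-linked {v} (p ∷ M) v∈ | inj₂ v∈M with endpoints-≥2-or-linked M v∈M
  ...   | inj₁ 2≤      = inj₁ (≤-trans 2≤ (m≤n+m _ _))
  ...   | inj₂ (w , l) = inj₂ (w , there l)

  endpoints-≥1-or-interior : ∀ {v} M → Unique (concat M) → v ∈ concat M →
                             1 ≤ occurrences v (endpoints M) ⊎ Interior M v
  endpoints-≥1-or-interior {v} (p ∷ M) u v∈ rewrite split v p M with ∈-++⁻ p v∈
  ... | inj₁ v∈p with ends-≥1-or-interior p v∈p
  ...   | inj₁ 1≤              = inj₁ (≤-trans 1≤ (m≤m+n _ _))
  ...   | inj₂ (_ , _ , c , d) = inj₂ (interior-here (unique-++⁻ˡ p u) c d)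
  endpoints-≥1-or-interior {v} (p ∷ M) u v∈ | inj₂ v∈M with endpoints-≥1-or-interior M (unique-++⁻ʳ p u) v∈M
  ...   | inj₁ 1≤                      = inj₁ (≤-trans 1≤ (m≤n+m _ _))
  ...   | inj₂ (x , y , x≢y , l₁ , l₂) = inj₂ (x , y , x≢y , there l₁ , there l₂)

  -- M with the path through v cut out and written as shape body; an uncovered v becomes a new one-vertex path.
  record Detached (M : List (List V)) (v : V) (shape : List V → List V) : Set where
    constructor detached
    field
      body  : List V
      rest  : List (List V)
      valid : IsPathSystem (shape body ∷ rest)
      to    : ∀ {x y} → Link M x y → Link (shape body ∷ rest) x y
      from  : ∀ {x y} → Link (shape body ∷ rest) x y → Link M x y
      fresh : ∀ {x} → x ∈ concat (shape body ∷ rest) → x ∈ concat M ⊎ x ≡ v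

  interior-map : ∀ {M M′ v} → (∀ {x y} → Link M′ x y → Link M x y) → Interior M′ v → Interior M v
  interior-map f (x , y , x≢y , l₁ , l₂) = x , y , x≢y , f l₁ , f l₂

  private
    data Located (a : V) (M : List (List V)) : Set where
      absent : a ∉ concat M → Located a M
      found  : ∀ q M′ → M ↭ q ∷ M′ → a ∈ q → Located a M

    locate : ∀ a M → Located a M
    locate a []      = absent λ ()
    locate a (p ∷ M) with a ∈? p
    ... | yes a∈p = found p M ↭-refl a∈p
    ... | no  a∉p with locate a M
    ...   | absent a∉M       = absent λ a∈ → [ a∉p , a∉M ]′ (∈-++⁻ p a∈)
    ...   | found q M′ σ a∈q = found q (p ∷ M′) (↭-trans (↭.prep p σ) (↭.swap p q ↭-refl)) a∈q

    isPathSystem-↭ : ∀ {M N} → M ↭ N → IsPathSystem M → IsPathSystem N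
    isPathSystem-↭ σ (oks , u) = All-resp-↭ σ oks , unique-↭ (concat-↭ σ) u

    detached-↭ : ∀ {M N v s} → M ↭ N → Detached N v s → Detached M v s
    detached-↭ σ (detached b r v t f fr) =
      detached b r v (t ∘ Any-resp-↭ σ) (Any-resp-↭ (↭-sym σ) ∘ f)
        (Data.Sum.map₁ (∈-resp-↭ (concat-↭ (↭-sym σ))) ∘ fr)

    reorient : ∀ {M v s s′} (f : List V → List V) → (∀ b → reverse (s b) ≡ s′ (f b)) →
               Detached M v s → Detached M v s′
    reorient {s = s} {s′} f eq (detached b r (ok ∷ oks , u) t fr fresh) =
      detached (f b) r valid′ (flip-link ∘ t) (fr ∘ unflip-link) (fresh ∘ unflip-∈)
      where
      reversal : reverse (s b) ++ concat r ↭ s b ++ concat r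
      reversal = ++⁺ʳ (concat r) (↭-reverse (s b))
      valid′ : IsPathSystem (s′ (f b) ∷ r)
      valid′ = subst (λ p → IsPathSystem (p ∷ r)) (eq b) (walkIn-reverse ok ∷ oks , unique-↭ (↭-sym reversal) u)
      flip-link : ∀ {x y} → Link (s b ∷ r) x y → Link (s′ (f b) ∷ r) x y
      flip-link (here c)  = here (subst (λ p → Adjacent p _ _) (eq b) (adjacent-reverse c))
      flip-link (there l) = there l
      unflip-link : ∀ {x y} → Link (s′ (f b) ∷ r) x y → Link (s b ∷ r) x y
      unflip-link (here c)  = here (adjacent-reverse⁻ (subst (λ p → Adjacent p _ _) (sym (eq b)) c))
      unflip-link (there l) = there l
      unflip-∈ : ∀ {x} → x ∈ s′ (f b) ++ concat r → x ∈ s b ++ concat r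
      unflip-∈ = ∈-resp-↭ reversal ∘ subst (λ p → _ ∈ p ++ concat r) (sym (eq b))

    orient : ∀ {a q M} → IsPathSystem (q ∷ M) → a ∈ q → Detached (q ∷ M) a (_∷ʳ a) ⊎ Interior (q ∷ M) a
    orient {a} {x ∷ l} {M} vM a∈ with a ≟ end x l | a ≟ x
    ... | yes refl | _ = let (init , eq) = end-∷ʳ x l in
      inj₁ (detached init M (subst (λ p → IsPathSystem (p ∷ M)) eq vM)
              (subst (λ p → Link (p ∷ M) _ _) eq) (subst (λ p → Link (p ∷ M) _ _) (sym eq))
              (inj₁ ∘ subst (λ p → _ ∈ p ++ concat M) (sym eq)))
    ... | no _ | yes refl = inj₁ (reorient {s = a ∷_} reverse (unfold-reverse a) (detached l M vM id id inj₁))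
    ... | no a≢end | no a≢x with a∈
    ...   | here a≡x  = contradiction a≡x a≢x
    ...   | there a∈l =
      inj₂ (interior-here (unique-++⁻ˡ (x ∷ l) (proj₂ vM))
              (proj₂ (predecessor-exists a∈l)) (proj₂ (successor-exists a∈ a≢end)))

  detach-end : ∀ {M a} → IsPathSystem M → T a ≡ true → Detached M a (_∷ʳ a) ⊎ Interior M a
  detach-end {M} {a} vM@(oks , u) Ta with locate a M
  ... | absent a∉ =
    inj₁ (detached [] M ((single a , Ta ∷ []) ∷ oks , ¬Any⇒All¬ _ a∉ ∷ u) there from-singleton fresh-singleton)
    where
    from-singleton : ∀ {x y} → Link ([ a ] ∷ M) x y → Link M x y
    from-singleton (here (inj₁ (there ())))
    from-singleton (here (inj₂ (there ())))
    from-singleton (there l) = l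
    fresh-singleton : ∀ {x} → x ∈ a ∷ concat M → x ∈ concat M ⊎ x ≡ a
    fresh-singleton (here x≡a)  = inj₂ x≡a
    fresh-singleton (there x∈M) = inj₁ x∈M
  ... | found q M′ σ a∈q with orient (isPathSystem-↭ σ vM) a∈q
  ...   | inj₁ d   = inj₁ (detached-↭ σ d)
  ...   | inj₂ int = inj₂ (interior-map (Any-resp-↭ (↭-sym σ)) int)

  detach-start : ∀ {M b} → IsPathSystem M → T b ≡ true → Detached M b (b ∷_) ⊎ Interior M b
  detach-start {b = b} vM Tb with detach-end vM Tb
  ... | inj₁ d   = inj₁ (reorient reverse (λ body → reverse-++ body [ b ]) d)
  ... | inj₂ int = inj₂ int

  -- Growing a path system edge by edge

  chain-join : ∀ init {a b r} → Chain G (init ∷ʳ a) → Chain G (b ∷ r) → adj a b ≡ true →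
               Chain G ((init ∷ʳ a) ++ (b ∷ r))
  chain-join []          (single _)         chb ab = cons _ _ _ ab chb
  chain-join (x ∷ [])    (cons _ _ _ xa _)  chb ab = cons _ _ _ xa (cons _ _ _ ab chb)
  chain-join (x ∷ y ∷ i) (cons _ _ _ xy ch) chb ab = cons _ _ _ xy (chain-join (y ∷ i) ch chb ab)

  record Extends (M : List (List V)) (a b : V) (M′ : List (List V)) : Set where
    field
      valid : IsPathSystem M′
      keeps : ∀ {x y} → Link M x y → Link M′ x y
      new   : ∀ {x y} → Link M′ x y → Link M x y ⊎ (x ≡ a × y ≡ b) ⊎ (x ≡ b × y ≡ a)

  extends-refl : ∀ {M a b} → IsPathSystem M → Extends M a b M
  extends-refl vM = record { valid = vM ; keeps = id ; new = inj₁ }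

  private
    join : ∀ {M a b} (pa : Detached M a (_∷ʳ a)) (pb : Detached (Detached.rest pa) b (b ∷_)) →
           adj a b ≡ true → b ∉ Detached.body pa ∷ʳ a →
           Extends M a b (((Detached.body pa ∷ʳ a) ++ (b ∷ Detached.body pb)) ∷ Detached.rest pb)
    join {M} {a} {b} (detached ia R₁ ((oka , Ra) ∷ _ , u₁) to₁ from₁ _)
                     (detached tb R₂ ((okb , Rb) ∷ oks₂ , u₂) to₂ from₂ fresh₂) ab b∉ =
      record { valid = (chain-join ia oka okb ab , All-++⁺ Ra Rb) ∷ oks₂ , unique
             ; keeps = keeps ; new = new }
      where
      pa : List V
      pa = ia ∷ʳ a
      unique : Unique ((pa ++ (b ∷ tb)) ++ concat R₂)
      unique = subst Unique (sym (++-assoc pa (b ∷ tb) (concat R₂)))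
        (Unique.++⁺ (unique-++⁻ˡ pa u₁) u₂ λ { (x∈pa , x∈rest) →
          [ unique-++-disjoint pa u₁ x∈pa , (λ { refl → b∉ x∈pa }) ]′ (fresh₂ x∈rest) })
      keeps : ∀ {x y} → Link M x y → Link ((pa ++ (b ∷ tb)) ∷ R₂) x y
      keeps l with to₁ l
      ... | here c = here (adjacent-++ˡ c)
      ... | there l₁ with to₂ l₁
      ...   | here c    = here (adjacent-++ʳ pa c)
      ...   | there l₂ = there l₂
      new : ∀ {x y} → Link ((pa ++ (b ∷ tb)) ∷ R₂) x y → Link M x y ⊎ (x ≡ a × y ≡ b) ⊎ (x ≡ b × y ≡ a)
      new (there l) = inj₁ (from₁ (there (from₂ (there l))))
      new (here (inj₁ c)) with consecutive-++⁻ ia a b tb c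
      ... | inj₁ c₁           = inj₁ (from₁ (here (inj₁ c₁)))
      ... | inj₂ (inj₁ c₂)    = inj₁ (from₁ (there (from₂ (here (inj₁ c₂)))))
      ... | inj₂ (inj₂ x≡a,y≡b) = inj₂ (inj₁ x≡a,y≡b)
      new (here (inj₂ c)) with consecutive-++⁻ ia a b tb c
      ... | inj₁ c₁                = inj₁ (from₁ (here (inj₂ c₁)))
      ... | inj₂ (inj₁ c₂)         = inj₁ (from₁ (there (from₂ (here (inj₂ c₂)))))
      ... | inj₂ (inj₂ (y≡a , x≡b)) = inj₂ (inj₂ (x≡b , y≡a))

  module Growth (acyclic : ¬ HasCycleIn G T) where

    private
      closing-edge : ∀ ia {a b R} → IsPathSystem ((ia ∷ʳ a) ∷ R) → adj a b ≡ true → b ∈ ia ∷ʳ a →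
                     Link ((ia ∷ʳ a) ∷ R) a b ⊎ Interior ((ia ∷ʳ a) ∷ R) b
      closing-edge [] _ ab (here refl) = contradiction refl (adj-≢ ab)
      closing-edge (x ∷ ia) {a} {b} ((ch , inT) ∷ _ , u) ab b∈ with b ≟ x
      closing-edge (x ∷ []) _ ab b∈ | yes refl = inj₁ (here (inj₂ here))
      closing-edge (x ∷ y ∷ ia) ((ch , inT) ∷ _ , u) ab b∈ | yes refl =
        contradiction (x , (y ∷ ia) ∷ʳ _ , s≤s (subst (1 ≤_) (sym (length-++ ia)) (m≤n+m 1 _)) ,
                       chain-join (x ∷ y ∷ ia) ch (single x) ab , unique-++⁻ˡ (x ∷ y ∷ ia ∷ʳ _) u , inT) acyclic
      ... | no b≢x with b∈
      ...   | here b≡x   = contradiction b≡x b≢x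
      ...   | there b∈tl with b ≟ a
      ...     | yes refl = contradiction refl (adj-≢ ab)
      ...     | no b≢a   = inj₂ (interior-here (unique-++⁻ˡ (x ∷ ia ∷ʳ a) u) (proj₂ (predecessor-exists b∈tl))
                                  (proj₂ (successor-exists b∈ (λ b≡end → b≢a (trans b≡end (end-of-∷ʳ x ia a))))))

    Outcome : List (List V) → V → V → List (List V) → Set
    Outcome M a b M′ = adj a b ≡ true → T a ≡ true → T b ≡ true → Link M′ a b ⊎ Interior M a ⊎ Interior M b

    insert : ∀ M → IsPathSystem M → ∀ a b → Σ (List (List V)) λ M′ → Extends M a b M′ × Outcome M a b M′
    insert M vM a b with adj a b in ab | T a in Ta | T b in Tb
    ... | false | _     | _     = M , extends-refl vM , λ ()
    ... | true  | false | _     = M , extends-refl vM , λ _ ()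
    ... | true  | true  | false = M , extends-refl vM , λ _ _ ()
    ... | true  | true  | true  with detach-end vM Ta
    ...   | inj₂ int = M , extends-refl vM , λ _ _ _ → inj₂ (inj₁ int)
    ...   | inj₁ pa@(detached ia R₁ v₁@(_ , u₁) _ from₁ _) with b ∈? (ia ∷ʳ a)
    ...     | yes b∈ = M , extends-refl vM , λ _ _ _ →
      Data.Sum.map from₁ (inj₂ ∘ interior-map from₁) (closing-edge ia v₁ ab b∈)
    ...     | no b∉ with detach-start (All.tail (proj₁ v₁) , unique-++⁻ʳ (ia ∷ʳ a) u₁) Tb
    ...       | inj₂ int = M , extends-refl vM , λ _ _ _ → inj₂ (inj₂ (interior-map (from₁ ∘ there) int))
    ...       | inj₁ pb@(detached tb _ _ _ _ _) =
      _ , join pa pb ab b∉ , λ _ _ _ → inj₁ (here (inj₁ (consecutive-join ia a b tb)))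

    record Grown (M : List (List V)) (E : List (V × V)) (M′ : List (List V)) : Set where
      field
        valid      : IsPathSystem M′
        keeps      : ∀ {x y} → Link M x y → Link M′ x y
        provenance : ∀ {x y} → Link M′ x y → Link M x y ⊎ (x , y) ∈ E ⊎ (y , x) ∈ E
        settled    : ∀ {a b} → (a , b) ∈ E → adj a b ≡ true → T a ≡ true → T b ≡ true →
                     Link M′ a b ⊎ Interior M′ a ⊎ Interior M′ b

    insertAll : ∀ M → IsPathSystem M → ∀ E → Σ (List (List V)) (Grown M E)
    insertAll M vM []            = M , record { valid = vM ; keeps = id ; provenance = inj₁ ; settled = λ () }
    insertAll M vM ((a , b) ∷ E) with insert M vM a b
    ... | M₁ , ext , outcome with insertAll M₁ (Extends.valid ext) E
    ...   | M₂ , grown = M₂ , record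
      { valid      = Grown.valid grown
      ; keeps      = Grown.keeps grown ∘ Extends.keeps ext
      ; provenance = provenance
      ; settled    = settled
      }
      where
      provenance : ∀ {x y} → Link M₂ x y → Link M x y ⊎ (x , y) ∈ (a , b) ∷ E ⊎ (y , x) ∈ (a , b) ∷ E
      provenance l with Grown.provenance grown l
      ... | inj₂ (inj₁ xy∈) = inj₂ (inj₁ (there xy∈))
      ... | inj₂ (inj₂ yx∈) = inj₂ (inj₂ (there yx∈))
      ... | inj₁ l₁ with Extends.new ext l₁
      ...   | inj₁ l₀                  = inj₁ l₀
      ...   | inj₂ (inj₁ (refl , refl)) = inj₂ (inj₁ (here refl))
      ...   | inj₂ (inj₂ (refl , refl)) = inj₂ (inj₂ (here refl))
      settled : ∀ {a′ b′} → (a′ , b′) ∈ (a , b) ∷ E → adj a′ b′ ≡ true → T a′ ≡ true → T b′ ≡ true →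
                Link M₂ a′ b′ ⊎ Interior M₂ a′ ⊎ Interior M₂ b′
      settled (there ab∈) = Grown.settled grown ab∈
      settled (here refl) ab Ta Tb with outcome ab Ta Tb
      ... | inj₁ l          = inj₁ (Grown.keeps grown l)
      ... | inj₂ (inj₁ int) = inj₂ (inj₁ (interior-map (Grown.keeps grown ∘ Extends.keeps ext) int))
      ... | inj₂ (inj₂ int) = inj₂ (inj₂ (interior-map (Grown.keeps grown ∘ Extends.keeps ext) int))

  uncovered : List (List V) → List V
  uncovered M = witnesses (λ v → T v ∧ not (does (v ∈? concat M)))

  complete : List (List V) → List (List V)
  complete M = M ++ map [_] (uncovered M)

  link-complete : ∀ {M x y} → Link M x y → Link (complete M) x y
  link-complete = Any-++⁺ˡ

  complete-cover : ∀ {M} → IsPathSystem M → IsPathCover G T (complete M)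
  complete-cover {M} (oks , u) = All-++⁺ (paths oks u) (All.tabulate singleton) , unique , covers
    where
    concat-complete : concat (complete M) ≡ concat M ++ uncovered M
    concat-complete = trans (sym (concat-++ M (map [_] (uncovered M)))) (cong (concat M ++_) (concat-map-[_] (uncovered M)))
    uncovered⁻ : ∀ {v} → v ∈ uncovered M → T v ≡ true × v ∉ concat M
    uncovered⁻ {v} v∈ with ∧-true (∈-witnesses⁻ _ v∈)
    ... | Tv , ¬covered = Tv , λ v∈M → false≢true (trans (sym (cong not (dec-true (v ∈? concat M) v∈M))) ¬covered)
    paths : ∀ {N} → All WalkIn N → Unique (concat N) → All (IsPathIn G T) N
    paths {[]}    []                  _ = []
    paths {p ∷ N} ((ch , inT) ∷ oks) u = (ch , inT , unique-++⁻ˡ p u) ∷ paths oks (unique-++⁻ʳ p u)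
    singleton : ∀ {p} → p ∈ map [_] (uncovered M) → IsPathIn G T p
    singleton p∈ with ∈-map⁻ [_] p∈
    ... | v , v∈ , refl = single v , proj₁ (uncovered⁻ v∈) ∷ [] , [] ∷ []
    unique : Unique (concat (complete M))
    unique = subst Unique (sym concat-complete)
      (Unique.++⁺ u (witnesses-unique _) λ { (v∈M , v∈U) → proj₂ (uncovered⁻ v∈U) v∈M })
    covers : ∀ v → T v ≡ true → v ∈ concat (complete M)
    covers v Tv rewrite concat-complete with v ∈? concat M
    ... | yes v∈M = ∈-++⁺ˡ v∈M
    ... | no  v∉M = ∈-++⁺ʳ (concat M) (∈-witnesses⁺ _ (∧-intro Tv (cong not (dec-false (v ∈? concat M) v∉M))))

-- Strong 4-cores

anyFin-intro : ∀ {n} (f : Fin n → Bool) v → f v ≡ true → anyFin f ≡ true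
anyFin-intro f fzero    fv rewrite fv = refl
anyFin-intro f (fsuc v) fv rewrite anyFin-intro (f ∘ fsuc) v fv = ∨-zeroʳ (f fzero)

module _ {n : ℕ} (G : Graph n) (C : VSet n) where

  open Graph G using (adj)
  open Parts G C

  A⇒¬C : ∀ {v} → Aset v ≡ true → C v ≡ false
  A⇒¬C {v} Av with C v
  ... | false = refl

  A⇒¬B : ∀ {v} → Aset v ≡ true → Bset v ≡ false
  A⇒¬B {v} Av with C v | Bset v
  ... | false | false = refl

  A-neighbour-∉C : ∀ {v u} → Aset v ≡ true → adj v u ≡ true → C u ≡ false
  A-neighbour-∉C {v} {u} Av vu with C u in Cu
  ... | false = refl
  ... | true  = contradiction (trans (sym (A⇒¬B Av)) v∈B) λ ()
    where
    v∈B : Bset v ≡ true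
    v∈B rewrite A⇒¬C Av = anyFin-intro (λ w → C w ∧ adj v w) u (∧-intro Cu vu)

  B⇒deg≥4 : IsStrong4Set G C → ∀ {v} → Bset v ≡ true → 4 ≤ deg G v
  B⇒deg≥4 strong {v} Bv = ≤-trans (strong v (∨-zeroʳ′ Bv)) (count-mono {f = λ u → adj v u ∧ C u} λ u → proj₁ ∘ ∧-true)
    where
    ∨-zeroʳ′ : ∀ {a b} → b ≡ true → a ∨ b ≡ true
    ∨-zeroʳ′ {a} refl = ∨-zeroʳ a

small⇒deg≤2 : ∀ {n} (G : Graph n) {v} → small G v ≡ true → deg G v ≤ 2
small⇒deg≤2 G {v} sv = ≤-pred (<ᵇ⇒< (deg G v) 3 (subst T (sym sv) tt))

¬small⇒deg≥3 : ∀ {n} (G : Graph n) {v} → small G v ≡ false → 3 ≤ deg G v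
¬small⇒deg≥3 G {v} sv = ≮⇒≥ λ deg<3 → false≢true (trans (sym sv) (Equivalence.to T-≡ (<⇒<ᵇ deg<3)))

module Setting {n : ℕ} (G : Graph n) (C : VSet n) (core : IsStrong4Core G C) (T : VSet n)
  (component : IsComponentOf G (Parts.ABset G C) T) (tree : IsTree G T)
  (few : sizeA G (Parts.Aset G C) T ≤ 3) where

  open Graph G using (adj)
  open Parts G C
  open PathSystems G T
  open Growth (proj₂ tree)

  private
    V = Fin n

  inA : V → Bool
  inA v = T v ∧ Aset v

  LA : List V
  LA = witnesses inA

  inA⇒T : ∀ {v} → inA v ≡ true → T v ≡ true
  inA⇒T = proj₁ ∘ ∧-true

  A-neighbour-∈T : ∀ {v u} → inA v ≡ true → adj v u ≡ true → T u ≡ true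
  A-neighbour-∈T {v} {u} iv vu with ∧-true iv
  ... | Tv , Av = proj₂ (proj₂ (proj₂ component)) v u Tv u∈AB vu
    where
    u∈AB : ABset u ≡ true
    u∈AB with Bset u
    ... | true  = ∨-zeroʳ (not (C u) ∧ false)
    ... | false rewrite A-neighbour-∉C G C Av vu = refl

  small⇒inA : ∀ {v} → T v ≡ true → small G v ≡ true → inA v ≡ true
  small⇒inA {v} Tv sv with Aset v in Av
  ... | true  = ∧-intro Tv refl
  ... | false = contradiction (≤-trans (B⇒deg≥4 G C (proj₁ core) v∈B) (small⇒deg≤2 G sv)) λ { (s≤s (s≤s ())) }
    where
    v∈B : Bset v ≡ true
    v∈B with proj₁ component v Tv
    ... | v∈AB rewrite Av = v∈AB

  no-four-A : ∀ {a b c d} → a ≢ b → a ≢ c → a ≢ d → b ≢ c → b ≢ d → c ≢ d →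
              inA a ≡ true → inA b ≡ true → inA c ≡ true → inA d ≡ true → ⊥
  no-four-A a≢b a≢c a≢d b≢c b≢d c≢d ia ib ic id =
    contradiction (≤-trans (count-≥4 inA a≢b a≢c a≢d b≢c b≢d c≢d ia ib ic id) few) λ { (s≤s (s≤s (s≤s ()))) }

  A-among-three : ∀ {a b c x} → a ≢ b → a ≢ c → b ≢ c →
                  inA a ≡ true → inA b ≡ true → inA c ≡ true → inA x ≡ true → x ≡ a ⊎ x ≡ b ⊎ x ≡ c
  A-among-three {a} {b} {c} {x} a≢b a≢c b≢c ia ib ic ix with x ≟ a | x ≟ b | x ≟ c
  ... | yes x≡a | _       | _       = inj₁ x≡a
  ... | no _    | yes x≡b | _       = inj₂ (inj₁ x≡b)
  ... | no _    | no _    | yes x≡c = inj₂ (inj₂ x≡c)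
  ... | no x≢a  | no x≢b  | no x≢c  = ⊥-elim (no-four-A a≢b a≢c (x≢a ∘ sym) b≢c (x≢b ∘ sym) (x≢c ∘ sym) ia ib ic ix)

  small-no-three-neighbours : ∀ {v a b c} → small G v ≡ true → a ≢ b → a ≢ c → b ≢ c →
                              adj v a ≡ true → adj v b ≡ true → adj v c ≡ true → ⊥
  small-no-three-neighbours sv a≢b a≢c b≢c va vb vc =
    contradiction (≤-trans (count-≥3 (adj _) a≢b a≢c b≢c va vb vc) (small⇒deg≤2 G sv)) λ { (s≤s (s≤s ())) }

  no-4-cycle : ∀ {a b c d} → a ≢ b → a ≢ c → a ≢ d → b ≢ c → b ≢ d → c ≢ d →
               adj a b ≡ true → adj b c ≡ true → adj c d ≡ true → adj d a ≡ true →
               T a ≡ true → T b ≡ true → T c ≡ true → T d ≡ true → ⊥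
  no-4-cycle a≢b a≢c a≢d b≢c b≢d c≢d ab bc cd da Ta Tb Tc Td = proj₂ tree
    (_ , _ ∷ _ ∷ _ ∷ [] , s≤s (s≤s z≤n) ,
     cons _ _ _ ab (cons _ _ _ bc (cons _ _ _ cd (cons _ _ _ da (single _)))) ,
     (a≢b ∷ a≢c ∷ a≢d ∷ []) ∷ (b≢c ∷ b≢d ∷ []) ∷ (c≢d ∷ []) ∷ [] ∷ [] ,
     Ta ∷ Tb ∷ Tc ∷ Td ∷ [])

  ∈LA⁺ : ∀ {v} → inA v ≡ true → v ∈ LA
  ∈LA⁺ = ∈-witnesses⁺ inA

  ∈LA⁻ : ∀ {v} → v ∈ LA → inA v ≡ true
  ∈LA⁻ = ∈-witnesses⁻ inA

  edgesAt : (V → Bool) → List (V × V)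
  edgesAt P = filterᵇ (P ∘ proj₁) (cartesianProduct LA (allFin n))

  ∈-edgesAt⁺ : ∀ {P v u} → inA v ≡ true → P v ≡ true → (v , u) ∈ edgesAt P
  ∈-edgesAt⁺ {P} {v} {u} iv Pv =
    ∈-filter⁺ (T? ∘ P ∘ proj₁) (∈-cartesianProduct⁺ (∈LA⁺ iv) (∈-allFin u)) (subst Data.Bool.T (sym Pv) tt)

  ∈-edgesAt⁻ : ∀ {P v u} → (v , u) ∈ edgesAt P → inA v ≡ true × P v ≡ true
  ∈-edgesAt⁻ {P} e∈ with ∈-filter⁻ (T? ∘ P ∘ proj₁) {xs = cartesianProduct LA (allFin n)} e∈
  ... | e∈LA×V , Pv = ∈LA⁻ (proj₁ (∈-cartesianProduct⁻ LA (allFin n) e∈LA×V)) , Equivalence.to T-≡ Pv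

  round₁ : Σ (List (List V)) (Grown [] (cartesianProduct LA LA))
  round₁ = insertAll [] ([] , []) (cartesianProduct LA LA)

  S₁ : List (List V)
  S₁ = proj₁ round₁

  round₂ : Σ (List (List V)) (Grown S₁ (edgesAt (small G)))
  round₂ = insertAll S₁ (Grown.valid (proj₂ round₁)) (edgesAt (small G))

  S₂ : List (List V)
  S₂ = proj₁ round₂

  round₃ : Σ (List (List V)) (Grown S₂ (edgesAt (not ∘ small G)))
  round₃ = insertAll S₂ (Grown.valid (proj₂ round₂)) (edgesAt (not ∘ small G))

  S₃ : List (List V)
  S₃ = proj₁ round₃

  open Grown (proj₂ round₁) using () renaming (valid to valid₁; provenance to provenance₁; settled to settled₁)
  open Grown (proj₂ round₂) using () renaming (valid to valid₂; keeps to keeps₁₂; provenance to provenance₂; settled to settled₂)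
  open Grown (proj₂ round₃) using () renaming (valid to valid₃; keeps to keeps₂₃; provenance to provenance₃; settled to settled₃)

  linked₁⇒A : ∀ {x y} → Link S₁ x y → inA x ≡ true × inA y ≡ true
  linked₁⇒A l with provenance₁ l
  ... | inj₁ ()
  ... | inj₂ (inj₁ xy∈) = let (x∈ , y∈) = ∈-cartesianProduct⁻ LA LA xy∈ in ∈LA⁻ x∈ , ∈LA⁻ y∈
  ... | inj₂ (inj₂ yx∈) = let (y∈ , x∈) = ∈-cartesianProduct⁻ LA LA yx∈ in ∈LA⁻ x∈ , ∈LA⁻ y∈

  linked₂⇒A : ∀ {x y} → Link S₂ x y →
              (inA x ≡ true × inA y ≡ true) ⊎ (inA x ≡ true × small G x ≡ true) ⊎ (inA y ≡ true × small G y ≡ true)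
  linked₂⇒A l with provenance₂ l
  ... | inj₁ l₁         = inj₁ (linked₁⇒A l₁)
  ... | inj₂ (inj₁ xy∈) = inj₂ (inj₁ (∈-edgesAt⁻ xy∈))
  ... | inj₂ (inj₂ yx∈) = inj₂ (inj₂ (∈-edgesAt⁻ yx∈))

  linked₃⇒A : ∀ {x y} → Link S₃ x y → inA x ≡ true ⊎ inA y ≡ true
  linked₃⇒A l with provenance₃ l
  ... | inj₂ (inj₁ xy∈) = inj₁ (proj₁ (∈-edgesAt⁻ xy∈))
  ... | inj₂ (inj₂ yx∈) = inj₂ (proj₁ (∈-edgesAt⁻ yx∈))
  ... | inj₁ l₂ with linked₂⇒A l₂
  ...   | inj₁ (ix , _)        = inj₁ ix
  ...   | inj₂ (inj₁ (ix , _)) = inj₁ ix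
  ...   | inj₂ (inj₂ (iy , _)) = inj₂ iy

  private
    A-interior₁⇒linked : ∀ {v w} → inA v ≡ true → inA w ≡ true → adj v w ≡ true → Interior S₁ v → Link S₁ v w
    A-interior₁⇒linked {v} {w} iv iw vw (p , q , p≢q , l₁ , l₂) with p ≟ w | q ≟ w
    ... | yes refl | _        = l₁
    ... | no _     | yes refl = l₂
    ... | no p≢w   | no q≢w   = ⊥-elim (no-four-A (adj-≢ vw) (adj-≢ (valid-adj valid₁ l₁)) (adj-≢ (valid-adj valid₁ l₂))
                                  (p≢w ∘ sym) (q≢w ∘ sym) p≢q iv iw (proj₂ (linked₁⇒A l₁)) (proj₂ (linked₁⇒A l₂)))

  A-edge-linked₁ : ∀ {v w} → inA v ≡ true → inA w ≡ true → adj v w ≡ true → Link S₁ v w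
  A-edge-linked₁ iv iw vw with settled₁ (∈-cartesianProduct⁺ (∈LA⁺ iv) (∈LA⁺ iw)) vw (inA⇒T iv) (inA⇒T iw)
  ... | inj₁ l          = l
  ... | inj₂ (inj₁ int) = A-interior₁⇒linked iv iw vw int
  ... | inj₂ (inj₂ int) = link-sym (A-interior₁⇒linked iw iv (adj-swap vw) int)

  A-edge-linked₃ : ∀ {v w} → inA v ≡ true → inA w ≡ true → adj v w ≡ true → Link S₃ v w
  A-edge-linked₃ iv iw vw = keeps₂₃ (keeps₁₂ (A-edge-linked₁ iv iw vw))

  Centre : V → V → Set
  Centre u v = Σ V λ w₁ → Σ V λ w₂ → w₁ ≢ w₂ × w₁ ≢ v × w₂ ≢ v × inA w₁ ≡ true × inA w₂ ≡ true ×
               small G w₁ ≡ true × small G w₂ ≡ true × Link S₂ u w₁ × Link S₂ u w₂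

  small-edge-linked₂ : ∀ {v u} → inA v ≡ true → small G v ≡ true → adj v u ≡ true →
                       Link S₂ v u ⊎ (inA u ≡ false × Centre u v)
  small-edge-linked₂ {v} {u} iv sv vu with settled₂ (∈-edgesAt⁺ iv sv) vu (inA⇒T iv) (A-neighbour-∈T iv vu)
  ... | inj₁ l = inj₁ l
  ... | inj₂ (inj₁ (p , q , p≢q , l₁ , l₂)) with p ≟ u | q ≟ u
  ...   | yes refl | _        = inj₁ l₁
  ...   | no _     | yes refl = inj₁ l₂
  ...   | no p≢u   | no q≢u   =
    ⊥-elim (small-no-three-neighbours sv p≢q p≢u q≢u (valid-adj valid₂ l₁) (valid-adj valid₂ l₂) vu)
  small-edge-linked₂ {v} {u} iv sv vu | inj₂ (inj₂ (p , q , p≢q , l₁ , l₂)) with inA u in iu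
  ... | true  = inj₁ (keeps₁₂ (A-edge-linked₁ iv iu vu))
  ... | false with p ≟ v | q ≟ v
  ...   | yes refl | _        = inj₁ (link-sym l₁)
  ...   | no _     | yes refl = inj₁ (link-sym l₂)
  ...   | no p≢v   | no q≢v   with small-A l₁ | small-A l₂
    where
    small-A : ∀ {x} → Link S₂ u x → inA x ≡ true × small G x ≡ true
    small-A l with linked₂⇒A l
    ... | inj₁ (iu′ , _)        = contradiction (trans (sym iu) iu′) λ ()
    ... | inj₂ (inj₁ (iu′ , _)) = contradiction (trans (sym iu) iu′) λ ()
    ... | inj₂ (inj₂ A,small)   = A,small
  ...     | ip , sp | iq , sq = inj₂ (refl , p , q , p≢q , p≢v , q≢v , ip , iq , sp , sq , l₁ , l₂)

  Blocked : V → V → Set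
  Blocked v x = inA x ≡ false × Σ V λ p → Σ V λ q → p ≢ q × p ≢ v × q ≢ v ×
                inA p ≡ true × inA q ≡ true × adj x p ≡ true × adj x q ≡ true

  interior₃⇒blocked : ∀ {v x} → inA v ≡ true → adj v x ≡ true → ¬ Link S₃ v x → Interior S₃ x → Blocked v x
  interior₃⇒blocked {v} {x} iv vx ¬l (p , q , p≢q , l₁ , l₂) with inA x in ix
  ... | true  = contradiction (A-edge-linked₃ iv ix vx) ¬l
  ... | false = refl , p , q , p≢q , (λ { refl → ¬l (link-sym l₁) }) , (λ { refl → ¬l (link-sym l₂) }) ,
                other-end l₁ , other-end l₂ , valid-adj valid₃ l₁ , valid-adj valid₃ l₂
    where
    other-end : ∀ {y} → Link S₃ x y → inA y ≡ true
    other-end l with linked₃⇒A l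
    ... | inj₁ ix′ = contradiction (trans (sym ix) ix′) λ ()
    ... | inj₂ iy  = iy

  private
    square : ∀ {v x y p q} → inA v ≡ true → adj v x ≡ true → adj v y ≡ true → x ≢ y → p ≢ q →
             inA p ≡ true → inA q ≡ true → adj x p ≡ true → adj x q ≡ true → adj y p ≡ true → adj y q ≡ true → ⊥
    square iv vx vy x≢y p≢q ip iq xp xq yp yq =
      no-4-cycle (adj-≢ xp) x≢y (adj-≢ xq) (adj-≢ yp ∘ sym) p≢q (adj-≢ yq)
        xp (adj-swap yp) yq (adj-swap xq) (A-neighbour-∈T iv vx) (inA⇒T ip) (A-neighbour-∈T iv vy) (inA⇒T iq)

  -- With at most three A-vertices, two blocked neighbours of v share their A-neighbours, closing a 4-cycle.
  two-blocked : ∀ {v x y} → inA v ≡ true → adj v x ≡ true → adj v y ≡ true → x ≢ y → Blocked v x → Blocked v y → ⊥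
  two-blocked iv vx vy x≢y (_ , p , q , p≢q , p≢v , q≢v , ip , iq , xp , xq) (_ , p′ , q′ , p′≢q′ , p′≢v , q′≢v , ip′ , iq′ , yp′ , yq′)
    with A-among-three (p≢v ∘ sym) (q≢v ∘ sym) p≢q iv ip iq ip′ | A-among-three (p≢v ∘ sym) (q≢v ∘ sym) p≢q iv ip iq iq′
  ... | inj₁ refl        | _                = p′≢v refl
  ... | _                | inj₁ refl        = q′≢v refl
  ... | inj₂ (inj₁ refl) | inj₂ (inj₁ refl) = p′≢q′ refl
  ... | inj₂ (inj₂ refl) | inj₂ (inj₂ refl) = p′≢q′ refl
  ... | inj₂ (inj₁ refl) | inj₂ (inj₂ refl) = square iv vx vy x≢y p≢q ip iq xp xq yp′ yq′
  ... | inj₂ (inj₂ refl) | inj₂ (inj₁ refl) = square iv vx vy x≢y p≢q ip iq xp xq yq′ yp′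

  big-edge-status : ∀ {v x} → inA v ≡ true → small G v ≡ false → adj v x ≡ true →
                    Interior S₃ v ⊎ Link S₃ v x ⊎ Blocked v x
  big-edge-status {v} {x} iv sv vx with link? S₃ v x
  ... | yes l = inj₂ (inj₁ l)
  ... | no ¬l with settled₃ (∈-edgesAt⁺ {not ∘ small G} iv (cong not sv)) vx (inA⇒T iv) (A-neighbour-∈T iv vx)
  ...   | inj₁ l          = contradiction l ¬l
  ...   | inj₂ (inj₁ int) = inj₁ int
  ...   | inj₂ (inj₂ int) = inj₂ (inj₂ (interior₃⇒blocked iv vx ¬l int))

  big-interior₃ : ∀ {v} → inA v ≡ true → small G v ≡ false → Interior S₃ v
  big-interior₃ {v} iv sv with count-≥3⇒witnesses (adj v) (¬small⇒deg≥3 G sv)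
  ... | a , b , c , a≢b , a≢c , b≢c , va , vb , vc with big-edge-status iv sv va | big-edge-status iv sv vb | big-edge-status iv sv vc
  ...   | inj₁ int         | _                | _                = int
  ...   | _                | inj₁ int         | _                = int
  ...   | _                | _                | inj₁ int         = int
  ...   | inj₂ (inj₁ la)   | inj₂ (inj₁ lb)   | _                = a , b , a≢b , la , lb
  ...   | inj₂ (inj₁ la)   | inj₂ (inj₂ _)    | inj₂ (inj₁ lc)   = a , c , a≢c , la , lc
  ...   | inj₂ (inj₂ _)    | inj₂ (inj₁ lb)   | inj₂ (inj₁ lc)   = b , c , b≢c , lb , lc
  ...   | inj₂ (inj₁ _)    | inj₂ (inj₂ bb)   | inj₂ (inj₂ bc)   = ⊥-elim (two-blocked iv vb vc b≢c bb bc)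
  ...   | inj₂ (inj₂ ba)   | inj₂ (inj₁ _)    | inj₂ (inj₂ bc)   = ⊥-elim (two-blocked iv va vc a≢c ba bc)
  ...   | inj₂ (inj₂ ba)   | inj₂ (inj₂ bb)   | _                = ⊥-elim (two-blocked iv va vb a≢b ba bb)

  -- Prespiders

  prespider : V → V → V → V → Bool
  prespider c x y z = T c ∧ T x ∧ T y ∧ T z ∧ (toℕ x <ᵇ toℕ y) ∧ (toℕ y <ᵇ toℕ z) ∧
                      adj c x ∧ adj c y ∧ adj c z ∧ small G x ∧ small G y ∧ small G z

  record Prespider (c x y z : V) : Set where
    field
      Tc  : T c ≡ true
      Tx  : T x ≡ true
      Ty  : T y ≡ true
      Tz  : T z ≡ true
      x<y : toℕ x < toℕ y
      y<z : toℕ y < toℕ z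
      cx  : adj c x ≡ true
      cy  : adj c y ≡ true
      cz  : adj c z ≡ true
      sx  : small G x ≡ true
      sy  : small G y ≡ true
      sz  : small G z ≡ true

  private
    <ᵇ-true⇒< : ∀ {m n} → (m <ᵇ n) ≡ true → m < n
    <ᵇ-true⇒< {m} {n} e = <ᵇ⇒< m n (subst Data.Bool.T (sym e) tt)

    <⇒<ᵇ-true : ∀ {m n} → m < n → (m <ᵇ n) ≡ true
    <⇒<ᵇ-true = Equivalence.to T-≡ ∘ <⇒<ᵇ

  prespider-sound : ∀ {c x y z} → prespider c x y z ≡ true → Prespider c x y z
  prespider-sound e =
    let (Tc , e) = ∧-true e ; (Tx , e) = ∧-true e ; (Ty , e) = ∧-true e ; (Tz , e) = ∧-true e
        (x<y , e) = ∧-true e ; (y<z , e) = ∧-true e ; (cx , e) = ∧-true e ; (cy , e) = ∧-true e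
        (cz , e) = ∧-true e ; (sx , e) = ∧-true e ; (sy , sz) = ∧-true e
    in record { Tc = Tc ; Tx = Tx ; Ty = Ty ; Tz = Tz ; x<y = <ᵇ-true⇒< x<y ; y<z = <ᵇ-true⇒< y<z
              ; cx = cx ; cy = cy ; cz = cz ; sx = sx ; sy = sy ; sz = sz }

  prespider-complete : ∀ {c x y z} → Prespider c x y z → prespider c x y z ≡ true
  prespider-complete P = ∧-intro Tc (∧-intro Tx (∧-intro Ty (∧-intro Tz (∧-intro (<⇒<ᵇ-true x<y) (∧-intro (<⇒<ᵇ-true y<z)
                           (∧-intro cx (∧-intro cy (∧-intro cz (∧-intro sx (∧-intro sy sz))))))))))
    where open Prespider P

  Among : V → V → V → V → Set
  Among x y z w = w ≡ x ⊎ w ≡ y ⊎ w ≡ z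

  among-elim : ∀ {P : V → Set} {a b d w} → Among a b d w → P a → P b → P d → P w
  among-elim (inj₁ refl)        pa _  _  = pa
  among-elim (inj₂ (inj₁ refl)) _  pb _  = pb
  among-elim (inj₂ (inj₂ refl)) _  _  pd = pd

  module _ {c x y z} (P : Prespider c x y z) where

    open Prespider P

    prespider-x≢y : x ≢ y
    prespider-x≢y refl = <-irrefl refl x<y

    prespider-x≢z : x ≢ z
    prespider-x≢z refl = <-irrefl refl (<-trans x<y y<z)

    prespider-y≢z : y ≢ z
    prespider-y≢z refl = <-irrefl refl y<z

    prespider-legs : ∀ {w} → inA w ≡ true → Among x y z w
    prespider-legs = A-among-three prespider-x≢y prespider-x≢z prespider-y≢z
                       (small⇒inA Tx sx) (small⇒inA Ty sy) (small⇒inA Tz sz)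

    A⇒centre-adj : ∀ {w} → inA w ≡ true → adj c w ≡ true
    A⇒centre-adj iw = among-elim (prespider-legs iw) cx cy cz

    among⇒≥x : ∀ {w} → Among x y z w → toℕ x ≤ toℕ w
    among⇒≥x (inj₁ refl)        = ≤-refl
    among⇒≥x (inj₂ (inj₁ refl)) = <⇒≤ x<y
    among⇒≥x (inj₂ (inj₂ refl)) = <⇒≤ (<-trans x<y y<z)

    among⇒≤z : ∀ {w} → Among x y z w → toℕ w ≤ toℕ z
    among⇒≤z (inj₁ refl)        = <⇒≤ (<-trans x<y y<z)
    among⇒≤z (inj₂ (inj₁ refl)) = <⇒≤ y<z
    among⇒≤z (inj₂ (inj₂ refl)) = ≤-refl

  prespider-unique : ∀ {c x y z c′ x′ y′ z′} → Prespider c x y z → Prespider c′ x′ y′ z′ →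
                     c′ ≡ c × x′ ≡ x × y′ ≡ y × z′ ≡ z
  prespider-unique {c} {x} {y} {z} {c′} {x′} {y′} {z′} P P′ = centres , x′≡x , y′≡y , z′≡z
    where
    open Prespider P
    open Prespider P′ renaming (Tc to Tc′; Tx to Tx′; Ty to Ty′; Tz to Tz′; x<y to x′<y′; y<z to y′<z′;
                                cx to c′x′; cy to c′y′; cz to c′z′; sx to sx′; sy to sy′; sz to sz′)
    legs : ∀ {w} → T w ≡ true → small G w ≡ true → Among x y z w
    legs Tw sw = prespider-legs P (small⇒inA Tw sw)
    legs′ : ∀ {w} → T w ≡ true → small G w ≡ true → Among x′ y′ z′ w
    legs′ Tw sw = prespider-legs P′ (small⇒inA Tw sw)
    x′≡x : x′ ≡ x
    x′≡x = toℕ-injective (≤-antisym (among⇒≥x P′ (legs′ Tx sx)) (among⇒≥x P (legs Tx′ sx′)))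
    z′≡z : z′ ≡ z
    z′≡z = toℕ-injective (≤-antisym (among⇒≤z P (legs Tz′ sz′)) (among⇒≤z P′ (legs′ Tz sz)))
    y′≡y : y′ ≡ y
    y′≡y with legs Ty′ sy′
    ... | inj₁ y′≡x        = contradiction (trans y′≡x (sym x′≡x)) (prespider-x≢y P′ ∘ sym)
    ... | inj₂ (inj₁ y′≡y) = y′≡y
    ... | inj₂ (inj₂ y′≡z) = contradiction (trans y′≡z (sym z′≡z)) (prespider-y≢z P′)
    c′x : adj c′ x ≡ true
    c′x = subst (λ w → adj c′ w ≡ true) x′≡x c′x′
    c′y : adj c′ y ≡ true
    c′y = subst (λ w → adj c′ w ≡ true) y′≡y c′y′
    centres : c′ ≡ c
    centres with c′ ≟ c
    ... | yes c′≡c = c′≡c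
    ... | no c′≢c  = ⊥-elim (no-4-cycle (adj-≢ cx) (c′≢c ∘ sym) (adj-≢ cy) (adj-≢ c′x ∘ sym) (prespider-x≢y P) (adj-≢ c′y)
                                         cx (adj-swap c′x) c′y (adj-swap cy) Tc Tx Tc′ Ty)

  prespiders-≥1 : ∀ {c x y z} → Prespider c x y z → 1 ≤ prespiders G T
  prespiders-≥1 {c} {x} {y} {z} P =
    ≤-trans (count-≥1 (prespider c x y) (prespider-complete P))
      (≤-trans (sumFin-≥ _ y) (≤-trans (sumFin-≥ _ x) (sumFin-≥ _ c)))

  prespiders-witness : 1 ≤ prespiders G T → Σ V λ c → Σ V λ x → Σ V λ y → Σ V λ z → Prespider c x y z
  prespiders-witness 1≤ with sumFin-≥1⇒witness _ 1≤
  ... | c , 1≤c with sumFin-≥1⇒witness _ 1≤c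
  ... | x , 1≤x with sumFin-≥1⇒witness _ 1≤x
  ... | y , 1≤y with count-≥1⇒witness (prespider c x y) 1≤y
  ... | z , e = c , x , y , z , prespider-sound e

  prespiders≡1 : ∀ {c x y z} → Prespider c x y z → prespiders G T ≡ 1
  prespiders≡1 {c} {x} {y} {z} P =
    trans (sumFin-unique _ c λ c′ c′≢c →
             sumFin-≡0 _ λ x′ → sumFin-≡0 _ λ y′ → count-≡0 λ z′ → none {c′} {x′} {y′} {z′} (c′≢c ∘ proj₁))
    (trans (sumFin-unique _ x λ x′ x′≢x →
             sumFin-≡0 _ λ y′ → count-≡0 λ z′ → none {c} {x′} {y′} {z′} (x′≢x ∘ proj₁ ∘ proj₂))
    (trans (sumFin-unique _ y λ y′ y′≢y →
             count-≡0 λ z′ → none {c} {x} {y′} {z′} (y′≢y ∘ proj₁ ∘ proj₂ ∘ proj₂))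
      (count-unique (prespider c x y) (prespider-complete P) λ z′ e →
         proj₂ (proj₂ (proj₂ (prespider-unique P (prespider-sound e)))))))
    where
    none : ∀ {c′ x′ y′ z′} → ¬ (c′ ≡ c × x′ ≡ x × y′ ≡ y × z′ ≡ z) → prespider c′ x′ y′ z′ ≡ false
    none {c′} {x′} {y′} {z′} ¬same with prespider c′ x′ y′ z′ in e
    ... | false = refl
    ... | true  = contradiction (prespider-unique P (prespider-sound e)) ¬same

  private
    sort-three : ∀ {a b d : V} → a ≢ b → a ≢ d → b ≢ d → Σ V λ x → Σ V λ y → Σ V λ z →
                 Among a b d x × Among a b d y × Among a b d z × toℕ x < toℕ y × toℕ y < toℕ z
    sort-three {a} {b} {d} a≢b a≢d b≢d with order a≢b | order b≢d | order a≢d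
      where
      order : ∀ {u w : V} → u ≢ w → toℕ u < toℕ w ⊎ toℕ w < toℕ u
      order {u} {w} u≢w with <-cmp (toℕ u) (toℕ w)
      ... | tri< u<w _ _ = inj₁ u<w
      ... | tri≈ _ u≡w _ = contradiction (toℕ-injective u≡w) u≢w
      ... | tri> _ _ w<u = inj₂ w<u
    ... | inj₁ a<b | inj₁ b<d | _        = a , b , d , inj₁ refl , inj₂ (inj₁ refl) , inj₂ (inj₂ refl) , a<b , b<d
    ... | inj₁ a<b | inj₂ d<b | inj₁ a<d = a , d , b , inj₁ refl , inj₂ (inj₂ refl) , inj₂ (inj₁ refl) , a<d , d<b
    ... | inj₁ a<b | inj₂ d<b | inj₂ d<a = d , a , b , inj₂ (inj₂ refl) , inj₁ refl , inj₂ (inj₁ refl) , d<a , a<b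
    ... | inj₂ b<a | inj₁ b<d | inj₁ a<d = b , a , d , inj₂ (inj₁ refl) , inj₁ refl , inj₂ (inj₂ refl) , b<a , a<d
    ... | inj₂ b<a | inj₁ b<d | inj₂ d<a = b , d , a , inj₂ (inj₁ refl) , inj₂ (inj₂ refl) , inj₁ refl , b<d , d<a
    ... | inj₂ b<a | inj₂ d<b | _        = d , b , a , inj₂ (inj₂ refl) , inj₂ (inj₁ refl) , inj₁ refl , d<b , b<a

  three-small-neighbours⇒prespider : ∀ {c a b d} → T c ≡ true → a ≢ b → a ≢ d → b ≢ d →
    T a ≡ true → T b ≡ true → T d ≡ true → adj c a ≡ true → adj c b ≡ true → adj c d ≡ true →
    small G a ≡ true → small G b ≡ true → small G d ≡ true → 1 ≤ prespiders G T
  three-small-neighbours⇒prespider Tc a≢b a≢d b≢d Ta Tb Td ca cb cd sa sb sd with sort-three a≢b a≢d b≢d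
  ... | x , y , z , ax , ay , az , x<y , y<z = prespiders-≥1 {x = x} {y} {z} record
    { Tc = Tc ; Tx = among-elim ax Ta Tb Td ; Ty = among-elim ay Ta Tb Td ; Tz = among-elim az Ta Tb Td
    ; x<y = x<y ; y<z = y<z
    ; cx = among-elim ax ca cb cd ; cy = among-elim ay ca cb cd ; cz = among-elim az ca cb cd
    ; sx = among-elim ax sa sb sd ; sy = among-elim ay sa sb sd ; sz = among-elim az sa sb sd }

  demand : ℕ → ℕ
  demand zero          = 2
  demand (suc zero)    = 1
  demand (suc (suc _)) = 0

  need : V → ℕ
  need v = demand (deg G v)

  nDeg≡sumOver : ∀ i → nDeg G Aset T i ≡ sumOver (λ v → bit (deg G v ≡ᵇ i)) LA
  nDeg≡sumOver i = trans (count-cong λ v → sym (∧-assoc (T v) (Aset v) _)) (count-∧ inA (λ v → deg G v ≡ᵇ i))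

  degree-count≡sumOver-need : 2 * nDeg G Aset T 0 + nDeg G Aset T 1 ≡ sumOver need LA
  degree-count≡sumOver-need rewrite nDeg≡sumOver 0 | nDeg≡sumOver 1 = go LA
    where
    per-vertex : ∀ v → 2 * bit (deg G v ≡ᵇ 0) + bit (deg G v ≡ᵇ 1) ≡ need v
    per-vertex v with deg G v
    ... | zero          = refl
    ... | suc zero      = refl
    ... | suc (suc _)   = refl
    go : ∀ L → 2 * sumOver (λ v → bit (deg G v ≡ᵇ 0)) L + sumOver (λ v → bit (deg G v ≡ᵇ 1)) L ≡ sumOver need L
    go []      = refl
    go (v ∷ L) = begin
      2 * (z + sumOver zs L) + (o + sumOver os L)         ≡⟨ cong (_+ (o + sumOver os L)) (*-distribˡ-+ 2 z (sumOver zs L)) ⟩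
      (2 * z + 2 * sumOver zs L) + (o + sumOver os L)     ≡⟨ +-interchange (2 * z) (2 * sumOver zs L) o (sumOver os L) ⟩
      (2 * z + o) + (2 * sumOver zs L + sumOver os L)     ≡⟨ cong₂ _+_ (per-vertex v) (go L) ⟩
      need v + sumOver need L                              ∎
      where
      open ≡-Reasoning
      zs os : V → ℕ
      zs w = bit (deg G w ≡ᵇ 0)
      os w = bit (deg G w ≡ᵇ 1)
      z = zs v
      o = os v

  cover-valid : ∀ {ps} → IsPathCover G T ps → IsPathSystem ps
  cover-valid (paths , u , _) = All.map (λ (ch , inT , _) → ch , inT) paths , u

  valid-∈T : ∀ {M v} → IsPathSystem M → v ∈ concat M → T v ≡ true
  valid-∈T (oks , _) v∈ = lookup (All-concat⁺ (All.map proj₂ oks)) v∈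

  endpoints-⊆ : ∀ {v} M → v ∈ endpoints M → v ∈ concat M
  endpoints-⊆ (p ∷ M) v∈ with ∈-++⁻ (ends p) v∈
  ... | inj₂ v∈M = ∈-++⁺ʳ p (endpoints-⊆ M v∈M)
  ... | inj₁ v∈ends with p | v∈ends
  ...   | x ∷ l | here refl         = here refl
  ...   | x ∷ l | there (here refl) = ∈-++⁺ˡ (end-∈ x l)

  private
    lastOf≡end : ∀ x l → lastOf G x l ≡ end x l
    lastOf≡end x []      = refl
    lastOf≡end x (y ∷ l) = lastOf≡end y l

    ind≡bit : ∀ b → ind G b ≡ bit b
    ind≡bit true  = refl
    ind≡bit false = refl

  endsIn≡sumOver : ∀ p → endsIn G Aset p ≡ sumOver (bit ∘ Aset) (ends p)
  endsIn≡sumOver []          = refl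
  endsIn≡sumOver (v ∷ [])    with Aset v
  ... | true  = refl
  ... | false = refl
  endsIn≡sumOver (v ∷ w ∷ l) rewrite lastOf≡end w l | +-identityʳ (bit (Aset (end w l))) =
    cong₂ _+_ (ind≡bit (Aset v)) (ind≡bit (Aset (end w l)))

  coverCost≡sumOver : ∀ ps → coverCost G Aset ps ≡ sumOver (bit ∘ Aset) (endpoints ps)
  coverCost≡sumOver []       = refl
  coverCost≡sumOver (p ∷ ps) = trans (cong₂ _+_ (endsIn≡sumOver p) (coverCost≡sumOver ps))
                                     (sym (sumOver-++ (bit ∘ Aset) (ends p) (endpoints ps)))

  coverCost≡sumOver-occurrences : ∀ {ps} → IsPathSystem ps →
    coverCost G Aset ps ≡ sumOver (λ v → occurrences v (endpoints ps)) LA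
  coverCost≡sumOver-occurrences {ps} vps = trans (coverCost≡sumOver ps)
    (sumOver-bit≡sumOver-occurrences Aset LA (endpoints ps) (witnesses-unique inA) (λ {v} → proj₂ ∘ ∧-true {T v} ∘ ∈LA⁻)
      λ e∈ Ae → ∈LA⁺ (∧-intro (valid-∈T vps (endpoints-⊆ ps e∈)) Ae))

  prespiders≡0 : ¬ 1 ≤ prespiders G T → prespiders G T ≡ 0
  prespiders≡0 = n≤0⇒n≡0 ∘ ≮⇒≥

  module LowerBound {ps} (cover : IsPathCover G T ps) where

    private
      valid : IsPathSystem ps
      valid = cover-valid cover

      unique : Unique (concat ps)
      unique = proj₂ valid

      linked-adj : ∀ {x y} → Link ps x y → adj x y ≡ true
      linked-adj = valid-adj valid

      covered : ∀ {v} → T v ≡ true → v ∈ concat ps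
      covered = proj₂ (proj₂ cover) _

    occ : V → ℕ
    occ v = occurrences v (endpoints ps)

    need≤occ : ∀ {v} → T v ≡ true → need v ≤ occ v
    need≤occ {v} Tv with deg G v in d
    ... | zero with endpoints-≥2-or-linked ps (covered Tv)
    ...   | inj₁ 2≤     = 2≤
    ...   | inj₂ (w , l) = contradiction (subst (1 ≤_) d (count-≥1 (adj v) (linked-adj l))) λ ()
    need≤occ {v} Tv | suc zero with endpoints-≥1-or-interior ps unique (covered Tv)
    ...   | inj₁ 1≤                          = 1≤
    ...   | inj₂ (p , q , p≢q , l₁ , l₂) =
      contradiction (subst (2 ≤_) d (count-≥2 (adj v) p≢q (linked-adj l₁) (linked-adj l₂))) λ { (s≤s ()) }
    need≤occ {v} Tv | suc (suc _) = z≤n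

    need<occ : ∀ {w c} → T w ≡ true → small G w ≡ true → adj w c ≡ true → ¬ Link ps w c → need w < occ w
    need<occ {w} {c} Tw sw wc ¬l with deg G w in d
    ... | zero = contradiction (subst (1 ≤_) d (count-≥1 (adj w) wc)) λ ()
    ... | suc zero with endpoints-≥2-or-linked ps (covered Tw)
    ...   | inj₁ 2≤     = 2≤
    ...   | inj₂ (u , l) = contradiction (subst (2 ≤_) d (count-≥2 (adj w) (λ { refl → ¬l l }) (linked-adj l) wc)) λ { (s≤s ()) }
    need<occ {w} {c} Tw sw wc ¬l | suc (suc zero) with endpoints-≥1-or-interior ps unique (covered Tw)
    ...   | inj₁ 1≤                      = 1≤
    ...   | inj₂ (p , q , p≢q , l₁ , l₂) = contradiction
      (subst (3 ≤_) d (count-≥3 (adj w) p≢q (λ { refl → ¬l l₁ }) (λ { refl → ¬l l₂ }) (linked-adj l₁) (linked-adj l₂) wc))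
      λ { (s≤s (s≤s ())) }
    need<occ {w} {c} Tw sw wc ¬l | suc (suc (suc _)) = ⊥-elim (false≢true sw)

    -- The centre is consecutive with at most two of its legs, so some leg is an endpoint once too often.
    prespider⇒excess : ∀ {c x y z} → Prespider c x y z → Σ V λ w → w ∈ LA × need w < occ w
    prespider⇒excess {c} {x} {y} {z} P with link? ps x c | link? ps y c | link? ps z c
    ... | no ¬l | _     | _     = x , ∈LA⁺ (small⇒inA Tx sx) , need<occ Tx sx (adj-swap cx) ¬l
      where open Prespider P
    ... | yes _ | no ¬l | _     = y , ∈LA⁺ (small⇒inA Ty sy) , need<occ Ty sy (adj-swap cy) ¬l
      where open Prespider P
    ... | yes _ | yes _ | no ¬l = z , ∈LA⁺ (small⇒inA Tz sz) , need<occ Tz sz (adj-swap cz) ¬l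
      where open Prespider P
    ... | yes lx | yes ly | yes lz = ⊥-elim (link-at-most-two unique (link-sym lx) (link-sym ly) (link-sym lz)
                                       (prespider-x≢y P) (prespider-x≢z P) (prespider-y≢z P))

    need≤occ-LA : ∀ {v} → v ∈ LA → need v ≤ occ v
    need≤occ-LA = need≤occ ∘ inA⇒T ∘ ∈LA⁻

    lower : sumOver need LA + prespiders G T ≤ sumOver occ LA
    lower with 1 ≤? prespiders G T
    ... | no ¬1≤ rewrite prespiders≡0 ¬1≤ | +-identityʳ (sumOver need LA) = sumOver-mono LA need≤occ-LA
    ... | yes 1≤ with prespiders-witness 1≤
    ...   | _ , _ , _ , _ , P with prespider⇒excess P
    ...     | w , w∈ , excess rewrite prespiders≡1 P | +-comm (sumOver need LA) 1 =
      sumOver-mono-strict LA need≤occ-LA w∈ excess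

  -- The optimal cover

  P : List (List V)
  P = complete S₃

  P-cover : IsPathCover G T P
  P-cover = complete-cover valid₃

  private
    occP : V → ℕ
    occP v = occurrences v (endpoints P)

    P-unique : Unique (concat P)
    P-unique = proj₂ (cover-valid P-cover)

    interior⇒occP≡0 : ∀ {v} → Interior S₃ v → occP v ≡ 0
    interior⇒occP≡0 = endpoints-interior P P-unique ∘ interior-map link-complete

    linked⇒occP≤1 : ∀ {v u} → Link S₃ v u → occP v ≤ 1
    linked⇒occP≤1 = endpoints-linked P P-unique ∘ link-complete

    occP≡0⇒≤ : ∀ {v k} → occP v ≡ 0 → occP v ≤ k
    occP≡0⇒≤ eq = subst (_≤ _) (sym eq) z≤n

  occP≤need : ∀ {v} → inA v ≡ true → (small G v ≡ true → ∀ {u} → adj v u ≡ true → Link S₃ v u) → occP v ≤ need v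
  occP≤need {v} iv all-linked with small G v in sv
  ... | false = occP≡0⇒≤ {v} (interior⇒occP≡0 (big-interior₃ iv sv))
  ... | true with deg G v in d
  ...   | zero = endpoints-≤2 v P P-unique
  ...   | suc zero = let (u , vu) = count-≥1⇒witness (adj v) (subst (1 ≤_) (sym d) ≤-refl) in
                     linked⇒occP≤1 (all-linked refl vu)
  ...   | suc (suc zero) = let (p , q , p≢q , vp , vq) = count-≥2⇒witnesses (adj v) (subst (2 ≤_) (sym d) ≤-refl) in
                           occP≡0⇒≤ {v} (interior⇒occP≡0 (p , q , p≢q , all-linked refl vp , all-linked refl vq))
  ...   | suc (suc (suc _)) = ⊥-elim (false≢true sv)

  -- A centre left over by the second round would be the centre of a prespider.
  no-prespider⇒linked : ¬ 1 ≤ prespiders G T → ∀ {v} → inA v ≡ true → small G v ≡ true →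
                        ∀ {u} → adj v u ≡ true → Link S₃ v u
  no-prespider⇒linked none {v} iv sv {u} vu with small-edge-linked₂ iv sv vu
  ... | inj₁ l = keeps₂₃ l
  ... | inj₂ (_ , w₁ , w₂ , w₁≢w₂ , w₁≢v , w₂≢v , iw₁ , iw₂ , sw₁ , sw₂ , l₁ , l₂) =
    ⊥-elim (none (three-small-neighbours⇒prespider (A-neighbour-∈T iv vu) (w₁≢v ∘ sym) (w₂≢v ∘ sym) w₁≢w₂
                   (inA⇒T iv) (inA⇒T iw₁) (inA⇒T iw₂) (adj-swap vu) (valid-adj valid₂ l₁) (valid-adj valid₂ l₂) sv sw₁ sw₂))

  upper-without-prespider : ¬ 1 ≤ prespiders G T → sumOver occP LA ≤ sumOver need LA + prespiders G T
  upper-without-prespider none rewrite prespiders≡0 none | +-identityʳ (sumOver need LA) =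
    sumOver-mono LA λ v∈ → occP≤need (∈LA⁻ v∈) (no-prespider⇒linked none (∈LA⁻ v∈))

  module WithPrespider {c x y z} (Pc : Prespider c x y z) where

    open Prespider Pc

    centre-unique : ∀ {v u} → inA v ≡ true → adj v u ≡ true → Centre u v → u ≡ c
    centre-unique {v} {u} iv vu (w₁ , _ , _ , w₁≢v , _ , iw₁ , _ , _ , _ , l₁ , _) with u ≟ c
    ... | yes u≡c = u≡c
    ... | no u≢c  = ⊥-elim (no-4-cycle (adj-≢ vu ∘ sym) u≢c (adj-≢ uw₁) (adj-≢ cv ∘ sym) (w₁≢v ∘ sym) (adj-≢ cw₁)
                                        (adj-swap vu) (adj-swap cv) cw₁ (adj-swap uw₁)
                                        (A-neighbour-∈T iv vu) (inA⇒T iv) Tc (inA⇒T iw₁))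
      where
      cv  = A⇒centre-adj Pc iv
      cw₁ = A⇒centre-adj Pc iw₁
      uw₁ = valid-adj valid₂ l₁

    linked-off-centre : ∀ {v u} → inA v ≡ true → small G v ≡ true → adj v u ≡ true → u ≢ c → Link S₃ v u
    linked-off-centre iv sv vu u≢c with small-edge-linked₂ iv sv vu
    ... | inj₁ l          = keeps₂₃ l
    ... | inj₂ (_ , cen) = contradiction (centre-unique iv vu cen) u≢c

    private
      deg≡2⇒small : ∀ {v} → deg G v ≡ 2 → small G v ≡ true
      deg≡2⇒small d = subst (λ k → (k <ᵇ 3) ≡ true) (sym d) refl

    missing : V → ℕ
    missing v = bit (not (does (link? S₃ v c)))

    occP≤need+missing : ∀ {v} → inA v ≡ true → occP v ≤ need v + missing v
    occP≤need+missing {v} iv with link? S₃ v c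
    ... | yes l = subst (occP v ≤_) (sym (+-identityʳ _)) (occP≤need iv all-linked)
      where
      all-linked : small G v ≡ true → ∀ {u} → adj v u ≡ true → Link S₃ v u
      all-linked sv {u} vu with u ≟ c
      ... | yes refl = l
      ... | no u≢c   = linked-off-centre iv sv vu u≢c
    ... | no _ with small G v in sv
    ...   | false = occP≡0⇒≤ {v} (interior⇒occP≡0 (big-interior₃ iv sv))
    ...   | true with deg G v in d
    ...     | zero     = ≤-trans (endpoints-≤2 v P P-unique) (s≤s (s≤s z≤n))
    ...     | suc zero = endpoints-≤2 v P P-unique
    ...     | suc (suc zero) with count-≥2⇒witnesses (adj v) (subst (2 ≤_) (sym d) ≤-refl)
    ...       | p , q , p≢q , vp , vq with p ≟ c
    ...         | no p≢c    = linked⇒occP≤1 (linked-off-centre iv (deg≡2⇒small d) vp p≢c)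
    ...         | yes refl = linked⇒occP≤1 (linked-off-centre iv (deg≡2⇒small d) vq (p≢q ∘ sym))
    occP≤need+missing {v} iv | no _ | true | suc (suc (suc _)) = ⊥-elim (false≢true sv)

    missing≥1⇒unlinked : ∀ {v} → 1 ≤ missing v → ¬ Link S₃ v c
    missing≥1⇒unlinked {v} 1≤ l with link? S₃ v c
    ... | yes _ = contradiction 1≤ λ ()
    ... | no ¬l = ¬l l

    missing-unique : ∀ {v w} → v ∈ LA → w ∈ LA → 1 ≤ missing v → 1 ≤ missing w → v ≡ w
    missing-unique {v} {w} v∈ w∈ 1≤v 1≤w
      with small-edge-linked₂ iv (among-elim (prespider-legs Pc iv) sx sy sz) (adj-swap (A⇒centre-adj Pc iv))
      where iv = ∈LA⁻ v∈
    ... | inj₁ l = contradiction (keeps₂₃ l) (missing≥1⇒unlinked 1≤v)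
    ... | inj₂ (_ , w₁ , w₂ , w₁≢w₂ , w₁≢v , w₂≢v , iw₁ , iw₂ , _ , _ , l₁ , l₂)
      with A-among-three (w₁≢v ∘ sym) (w₂≢v ∘ sym) w₁≢w₂ (∈LA⁻ v∈) iw₁ iw₂ (∈LA⁻ w∈)
    ...   | inj₁ w≡v          = sym w≡v
    ...   | inj₂ (inj₁ refl) = contradiction (keeps₂₃ (link-sym l₁)) (missing≥1⇒unlinked 1≤w)
    ...   | inj₂ (inj₂ refl) = contradiction (keeps₂₃ (link-sym l₂)) (missing≥1⇒unlinked 1≤w)

    upper-with-prespider : sumOver occP LA ≤ sumOver need LA + prespiders G T
    upper-with-prespider rewrite prespiders≡1 Pc = begin
      sumOver occP LA                                  ≤⟨ sumOver-mono LA (occP≤need+missing ∘ ∈LA⁻) ⟩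
      sumOver (λ v → need v + missing v) LA            ≡⟨ sumOver-+ need missing LA ⟩
      sumOver need LA + sumOver missing LA             ≤⟨ +-monoʳ-≤ (sumOver need LA)
                                                            (sumOver-≤1 missing LA (witnesses-unique inA) missing≤1 missing-unique) ⟩
      sumOver need LA + 1                              ∎
      where
      open ≤-Reasoning
      missing≤1 : ∀ v → missing v ≤ 1
      missing≤1 v with does (link? S₃ v c)
      ... | true  = z≤n
      ... | false = ≤-refl

  upper : sumOver occP LA ≤ sumOver need LA + prespiders G T
  upper with 1 ≤? prespiders G T
  ... | no none = upper-without-prespider none
  ... | yes 1≤  = let (_ , _ , _ , _ , Pc) = prespiders-witness 1≤ in WithPrespider.upper-with-prespider Pc

  cost-formula : ℕ
  cost-formula = 2 * nDeg G Aset T 0 + nDeg G Aset T 1 + prespiders G T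

  P-cost : coverCost G Aset P ≡ cost-formula
  P-cost = begin
    coverCost G Aset P                   ≡⟨ coverCost≡sumOver-occurrences (cover-valid P-cover) ⟩
    sumOver occP LA                      ≡⟨ ≤-antisym upper (LowerBound.lower P-cover) ⟩
    sumOver need LA + prespiders G T     ≡⟨ cong (_+ prespiders G T) degree-count≡sumOver-need ⟨
    cost-formula                         ∎
    where open ≡-Reasoning

  cost-formula≤coverCost : ∀ ps → IsPathCover G T ps → cost-formula ≤ coverCost G Aset ps
  cost-formula≤coverCost ps cover = begin
    cost-formula                                              ≡⟨ cong (_+ prespiders G T) degree-count≡sumOver-need ⟩
    sumOver need LA + prespiders G T                          ≤⟨ LowerBound.lower cover ⟩
    sumOver (λ v → occurrences v (endpoints ps)) LA           ≡⟨ coverCost≡sumOver-occurrences (cover-valid cover) ⟨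
    coverCost G Aset ps                                       ∎
    where open ≤-Reasoning

lemma5p4 : ∀ {n : ℕ} (G : Graph n) (C : VSet n) → IsStrong4Core G C →
    (T : VSet n) → IsComponentOf G (Parts.ABset G C) T → IsTree G T →
    sizeA G (Parts.Aset G C) T ≤ 3 →
    (Σ (List (List (Fin n))) λ ps → IsPathCover G T ps ×
        coverCost G (Parts.Aset G C) ps
          ≡ 2 * nDeg G (Parts.Aset G C) T 0 + nDeg G (Parts.Aset G C) T 1 + prespiders G T)
    × (∀ ps → IsPathCover G T ps →
        2 * nDeg G (Parts.Aset G C) T 0 + nDeg G (Parts.Aset G C) T 1 + prespiders G T
          ≤ coverCost G (Parts.Aset G C) ps)
lemma5p4 G C core T component tree few = (P , P-cover , P-cost) , cost-formula≤coverCost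
  where open Setting G C core T component tree few
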